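{- Let $n\ge 2$ be an integer and consider the game $SN(n,A)$ with $A=\{n-1,n\}$. For a position $\mathbf p$ let $s=\Sigma(\mathbf p)\bmod (2n-2)$ (taken in $\{0,\dots,2n-3\}$) and let $o$ be the number of indices $i$ with $p_i$ odd. Then for every position $s$ and $o$ have the same parity. Moreover, a reduced position $\mathbf p$ is a P-position of $SN(n,A)$ if and only if its pair $(s,o)$ belongs to $S_1\cup S_2\cup S_3$, where $S_1=\{(s,o): s\equiv o\pmod 2,\ 0\le s<n-2,\ o\le s\}$, $S_2=\{(n-2,o): o\equiv n\pmod 2,\ 0\le o\le n-2\}$, $S_3=\{(s,o): s\equiv o\pmod 2,\ n-2<s<2n-3,\ o\le 2(n-2)-s\}$.
   Context: For an integer $n\ge 1$ and a nonempty set $A\subseteq\{1,\dots,n\}$, the game $SN(n,A)$ (Slow SetNim) is played on $n$ stacks of tokens; a position is $\mathbf p=(p_1,\dots,p_n)$ of nonnegative integers ($p_i$ is the height of stack $i$), written in non-decreasing order so that $p_n=\max_i p_i$; stacks of height $0$ still count as stacks. A move consists of choosing some $\ell\in A$ and $\ell$ distinct stacks, each of height at least $1$, and removing exactly one token from each chosen stack. Players alternate; a player unable to move loses (normal play). A P-position is one from which the player to move loses under optimal play; an N-position is one from which the player to move wins. $\Sigma(\mathbf p)=\sum_i p_i$. A terminal position is one with no legal move. For a position $\mathbf p$, let $\mathcal T(\mathbf p)$ be the set of terminal positions reachable from $\mathbf p$ by finite sequences of legal moves, let $u_i(\mathbf p)=\min\{t_i:\mathbf t\in\mathcal T(\mathbf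 p)\}$, and define the reduction $r(\mathbf p)=\mathbf p-u(\mathbf p)$. The position $\mathbf p$ is reduced if $r(\mathbf p)=\mathbf p$. -}

module Defs where

open import Data.Nat using (ℕ; zero; suc; _+_; _*_; _∸_; _≤_; _<_; _%_; NonZero; >-nonZero; s≤s; z≤n)
open import Data.Nat.Properties using (≤-trans; ∸-monoˡ-≤; *-monoʳ-≤; _≟_)
open import Data.Fin using (Fin)
import Data.Fin as F
open import Data.Fin.Subset using (Subset; _∈_; _∉_; ∣_∣)
open import Data.List using (List; map; filter; length; allFin)
open import Data.Nat.ListAction using (sum)
open import Data.Product using (Σ; ∃; _×_)
open import Data.Sum using (_⊎_)
open import Relation.Nullary using (¬_)
open import Relation.Binary.PropositionalEquality using (_≡_)
open import Relation.Binary.Construct.Closure.ReflexiveTransitive using (Star)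

Position : ℕ → Set
Position n = Fin n → ℕ

-- the paper writes positions in non-decreasing order
Sorted : ∀ {n} → Position n → Set
Sorted {n} p = ∀ (i j : Fin n) → i F.≤ j → p i ≤ p j

Move : ∀ {n} → (ℕ → Set) → Position n → Position n → Set
Move {n} A p q =
  Σ (Subset n) λ S →
    A ∣ S ∣ ×
    (∀ i → i ∈ S → (1 ≤ p i) × (q i ≡ p i ∸ 1)) ×
    (∀ i → i ∉ S → q i ≡ p i)

mutual
  data IsP {n} (A : ℕ → Set) (p : Position n) : Set where
    isP : (∀ q → Move A p q → IsN A q) → IsP A p

  data IsN {n} (A : ℕ → Set) (p : Position n) : Set where
    isN : ∀ q → Move A p q → IsP A q → IsN A p

Terminal : ∀ {n} → (ℕ → Set) → Position n → Set
Terminal A t = ∀ q → ¬ Move A t q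

Reachable : ∀ {n} → (ℕ → Set) → Position n → Position n → Set
Reachable A = Star (Move A)

InT : ∀ {n} → (ℕ → Set) → Position n → Position n → Set
InT A p t = Reachable A p t × Terminal A t

IsU : ∀ {n} → (ℕ → Set) → Position n → Fin n → ℕ → Set
IsU A p i m = (Σ _ λ t → InT A p t × (t i ≡ m)) × (∀ t → InT A p t → m ≤ t i)

-- p is reduced: r(p) = p - u(p) equals p
Reduced : ∀ {n} → (ℕ → Set) → Position n → Set
Reduced A p = ∀ i → Σ ℕ λ m → IsU A p i m × (p i ∸ m ≡ p i)

Σp : ∀ {n} → Position n → ℕ
Σp {n} p = sum (map p (allFin n))

oddCount : ∀ {n} → Position n → ℕ
oddCount {n} p = length (filter (λ i → p i % 2 ≟ 1) (allFin n))

A₆ : ℕ → ℕ → Set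
A₆ n ℓ = (ℓ ≡ n ∸ 1) ⊎ (ℓ ≡ n)

modulus-pos : ∀ n → 2 ≤ n → 0 < 2 * n ∸ 2
modulus-pos n h = ≤-trans (s≤s z≤n) (∸-monoˡ-≤ 2 (*-monoʳ-≤ 2 h))

sVal : ∀ n → 2 ≤ n → Position n → ℕ
sVal n h p = _%_ (Σp p) (2 * n ∸ 2) {{>-nonZero (modulus-pos n h)}}

S₁ : ℕ → ℕ → ℕ → Set
S₁ n s o = (s % 2 ≡ o % 2) × (s < n ∸ 2) × (o ≤ s)

S₂ : ℕ → ℕ → ℕ → Set
S₂ n s o = (s ≡ n ∸ 2) × (o % 2 ≡ n % 2) × (o ≤ n ∸ 2)

S₃ : ℕ → ℕ → ℕ → Set
S₃ n s o = (s % 2 ≡ o % 2) × (n ∸ 2 < s) × (s < 2 * n ∸ 3) × (o ≤ 2 * (n ∸ 2) ∸ s)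

-- Put m = n − 1 and N = 2m = 2n − 2, and call p balanced when m·pᵢ ≤ Σp for every i. Reduced
-- positions are balanced: every move removes at least m tokens but at most one from stack i, so
-- any play that empties stack i removes at least m·pᵢ tokens. Since N is even, s ≡ Σp ≡ o (mod 2).
-- For balanced p we show by induction on Σp that p is a P-position iff o ≤ s and o + s ≤ 2(n − 2),
-- which is S₁ ∪ S₂ ∪ S₃ in closed form. A move of ℓ ∈ {m, n} tokens sends s to s − ℓ (mod N) and
-- changes the parity of exactly ℓ stacks: no move joins two such pairs (s, o), and from any other
-- balanced position the move sparing a single suitable stack, or the move touching all stacks,
-- reaches one. A move may destroy balance; the resulting q is then compared with a smaller balanced
-- r (one token fewer on every stack, and on the tallest stacks one more when Σc = m·max c) that
-- differs from q only on stacks too high to be emptied in the few moves left from q, so q and r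
-- have the same outcome.

module Submission where

open import Defs
open import Data.Bool using (true; false; if_then_else_)
open import Data.Empty using (⊥; ⊥-elim)
open import Data.Fin using (Fin; zero; suc)
import Data.Fin as F
open import Data.Fin.Properties using (any?)
open import Data.Fin.Subset using (Subset; _∈_; _∉_; ∣_∣; ⊤; ⁅_⁆; ∁)
open import Data.Fin.Subset.Properties
  using (_∈?_; ∈⊤; ∣⊤∣≡n; ∣p∣≡n⇒p≡⊤; ∣∁p∣≡n∸∣p∣; ∣⁅x⁆∣≡1; x∈⁅y⁆⇒x≡y; x∉⁅y⁆⇒x≢y; x∈∁p⇒x∉p; x∉∁p⇒x∈p)
open import Data.List using ([]; _∷_; map; tabulate; allFin; filter; length)
open import Data.List.Extrema.Nat using (argmax; f[xs]≤f[argmax])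
open import Data.List.Membership.Propositional.Properties using (∈-allFin)
open import Data.List.Properties using (map-tabulate; filter-accept; filter-reject)
import Data.List.Relation.Unary.All as All
open import Data.Nat
open import Data.Nat.DivMod
open import Data.Nat.Divisibility using (m∣m*n)
import Data.Nat.ListAction as ListAction
open import Data.Nat.Properties
open import Data.Nat.Tactic.RingSolver using (solve-∀; solve)
open import Data.Product using (Σ; ∃; _×_; _,_; proj₁; proj₂)
open import Data.Sum using (_⊎_; inj₁; inj₂)
open import Data.Vec as Vec using (lookup)
open import Data.Vec.Properties using ([]=⇒lookup; lookup⇒[]=; lookup∘tabulate)
open import Algebra.Properties.CommutativeMonoid.Sum +-0-commutativeMonoid using (sum; ∑-distrib-+; sum-cong-≗)
open import Algebra.Properties.CommutativeSemigroup +-commutativeSemigroup using (xy∙z≈xz∙y; x∙yz≈y∙xz)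
open import Algebra.Properties.Semiring.Sum +-*-semiring using (*-distribˡ-sum)
open import Function using (_∘_; id)
open import Function.Bundles using (_⇔_; mk⇔)
open import Function.Construct.Composition using (_⇔-∘_)
open import Relation.Binary.Construct.Closure.ReflexiveTransitive using (Star; ε; _◅_)
open import Relation.Binary.Definitions using (tri<; tri≈; tri>)
open import Relation.Binary.PropositionalEquality
open import Relation.Nullary using (Dec; yes; no; does; ¬_; ¬?; _×-dec_; contradiction)
open import Relation.Nullary.Decidable using (dec-true; dec-false)

2+n≰n : ∀ {x} → ¬ (2 + x ≤ x)
2+n≰n = 1+n≰n ∘ ≤-trans (n≤1+n _)

sum-mono-≤ : ∀ {n} {f g : Fin n → ℕ} → (∀ i → f i ≤ g i) → sum f ≤ sum g
sum-mono-≤ {zero}  _   = z≤n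
sum-mono-≤ {suc n} f≤g = +-mono-≤ (f≤g zero) (sum-mono-≤ (f≤g ∘ suc))

sum-const : ∀ n c → sum {n} (λ _ → c) ≡ n * c
sum-const zero    c = refl
sum-const (suc n) c = cong (c +_) (sum-const n c)

f≤sum : ∀ {n} (f : Fin n → ℕ) i → f i ≤ sum f
f≤sum f zero    = m≤m+n (f zero) _
f≤sum f (suc i) = ≤-trans (f≤sum (f ∘ suc) i) (m≤n+m _ (f zero))

f+f≤sum : ∀ {n} (f : Fin n → ℕ) {i j} → i ≢ j → f i + f j ≤ sum f
f+f≤sum f {zero}  {zero}  i≢j = contradiction refl i≢j
f+f≤sum f {zero}  {suc j} _   = +-monoʳ-≤ (f zero) (f≤sum (f ∘ suc) j)
f+f≤sum f {suc i} {zero}  _   =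
  subst (_≤ sum f) (+-comm (f zero) (f (suc i))) (+-monoʳ-≤ (f zero) (f≤sum (f ∘ suc) i))
f+f≤sum f {suc i} {suc j} i≢j = ≤-trans (f+f≤sum (f ∘ suc) (i≢j ∘ cong suc)) (m≤n+m _ (f zero))

sum-allFin : ∀ {n} (f : Fin n → ℕ) → ListAction.sum (map f (allFin n)) ≡ sum f
sum-allFin f = trans (cong ListAction.sum (map-tabulate id f)) (sum-tabulate f)
  where
  sum-tabulate : ∀ {n} (g : Fin n → ℕ) → ListAction.sum (tabulate g) ≡ sum g
  sum-tabulate {zero}  g = refl
  sum-tabulate {suc n} g = cong (g zero +_) (sum-tabulate (g ∘ suc))

-- Parity

-- suc (suc x) % 2 computes to x % 2, which drives the recursions below.
%2-cases : ∀ x → x % 2 ≡ 0 ⊎ x % 2 ≡ 1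
%2-cases 0             = inj₁ refl
%2-cases 1             = inj₂ refl
%2-cases (suc (suc x)) = %2-cases x

%2-suc : ∀ x → suc x % 2 + x % 2 ≡ 1
%2-suc 0             = refl
%2-suc 1             = refl
%2-suc (suc (suc x)) = %2-suc x

%2-flip : ∀ {p q} → q + 1 ≡ p → p % 2 + q % 2 ≡ 1
%2-flip {q = q} refl = subst (λ x → x % 2 + q % 2 ≡ 1) (+-comm 1 q) (%2-suc q)

%2-suc≢ : ∀ x → suc x % 2 ≢ x % 2
%2-suc≢ 0             ()
%2-suc≢ 1             ()
%2-suc≢ (suc (suc x)) = %2-suc≢ x

%2-double : ∀ x → (2 * x) % 2 ≡ 0
%2-double x = trans (cong (_% 2) (*-comm 2 x)) (m*n%n≡0 x 2)

%2-gap : ∀ {x y} → x % 2 ≡ y % 2 → x < y → 2 + x ≤ y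
%2-gap {0}           {1}                 ()
%2-gap {0}           {suc (suc y)}       _  _                = s≤s (s≤s z≤n)
%2-gap {1}           {1}                 _  (s≤s ())
%2-gap {1}           {2}                 ()
%2-gap {1}           {suc (suc (suc y))} _  _                = s≤s (s≤s (s≤s z≤n))
%2-gap {suc (suc x)} {suc (suc y)}       e  (s≤s (s≤s x<y)) = s≤s (s≤s (%2-gap e x<y))

sum-%2 : ∀ {n} (f : Fin n → ℕ) → sum f % 2 ≡ sum (λ i → f i % 2) % 2
sum-%2 {zero}  f = refl
sum-%2 {suc n} f = begin
  (f zero + sum (f ∘ suc)) % 2        ≡⟨ %-distribˡ-+ (f zero) _ 2 ⟩
  (f zero % 2 + sum (f ∘ suc) % 2) % 2 ≡⟨ cong (λ x → (f zero % 2 + x) % 2) (sum-%2 (f ∘ suc)) ⟩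
  (f zero % 2 + rest % 2) % 2         ≡⟨ cong (λ x → (x + rest % 2) % 2) (sym (m%n%n≡m%n (f zero) 2)) ⟩
  (f zero % 2 % 2 + rest % 2) % 2     ≡⟨ %-distribˡ-+ (f zero % 2) rest 2 ⟨
  (f zero % 2 + rest) % 2             ∎
  where
  open ≡-Reasoning
  rest : ℕ
  rest = sum (λ i → f (suc i) % 2)

oddSum : ∀ {n} → Position n → ℕ
oddSum p = sum (λ i → p i % 2)

oddCount≡oddSum : ∀ {n} (p : Position n) → oddCount p ≡ oddSum p
oddCount≡oddSum {n} p = count id
  where
  odd? : ∀ i → Dec (p i % 2 ≡ 1)
  odd? i = p i % 2 ≟ 1
  count : ∀ {n′} (g : Fin n′ → Fin n) →
          length (filter odd? (tabulate g)) ≡ sum (λ i → p (g i) % 2)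
  count {zero}   g = refl
  count {suc n′} g with %2-cases (p (g zero))
  ... | inj₁ even = begin
    length (filter odd? (tabulate g))
      ≡⟨ cong length (filter-reject odd? λ odd → 0≢1+n (trans (sym even) odd)) ⟩
    length (filter odd? (tabulate (g ∘ suc))) ≡⟨ count (g ∘ suc) ⟩
    sum (λ i → p (g (suc i)) % 2)              ≡⟨ cong (_+ sum (λ i → p (g (suc i)) % 2)) even ⟨
    p (g zero) % 2 + sum (λ i → p (g (suc i)) % 2) ∎
    where open ≡-Reasoning
  ... | inj₂ odd = begin
    length (filter odd? (tabulate g))             ≡⟨ cong length (filter-accept odd? odd) ⟩
    suc (length (filter odd? (tabulate (g ∘ suc)))) ≡⟨ cong suc (count (g ∘ suc)) ⟩
    1 + sum (λ i → p (g (suc i)) % 2)             ≡⟨ cong (_+ sum (λ i → p (g (suc i)) % 2)) odd ⟨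
    p (g zero) % 2 + sum (λ i → p (g (suc i)) % 2) ∎
    where open ≡-Reasoning

-- Removing one token from each stack of a subset

indicator : ∀ {n} → Subset n → Fin n → ℕ
indicator S i = if lookup S i then 1 else 0

module _ {n : ℕ} {S : Subset n} {i : Fin n} where

  indicator-∈ : i ∈ S → indicator S i ≡ 1
  indicator-∈ i∈S rewrite []=⇒lookup i∈S = refl

  indicator-∉ : i ∉ S → indicator S i ≡ 0
  indicator-∉ i∉S with lookup S i in eq
  ... | true  = contradiction (lookup⇒[]= i S eq) i∉S
  ... | false = refl


indicator≤1 : ∀ {n} (S : Subset n) i → indicator S i ≤ 1
indicator≤1 S i with i ∈? S
... | yes i∈S = ≤-reflexive (indicator-∈ i∈S)
... | no  i∉S = ≤-trans (≤-reflexive (indicator-∉ i∉S)) z≤n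

∣S∣≡sum-indicator : ∀ {n} (S : Subset n) → ∣ S ∣ ≡ sum (indicator S)
∣S∣≡sum-indicator Vec.[]          = refl
∣S∣≡sum-indicator (true  Vec.∷ S) = cong suc (∣S∣≡sum-indicator S)
∣S∣≡sum-indicator (false Vec.∷ S) = ∣S∣≡sum-indicator S

record Removes {n} (S : Subset n) (p q : Position n) : Set where
  constructor removes
  field height : ∀ i → q i + indicator S i ≡ p i
open Removes

lower : ∀ {n} → Subset n → Position n → Position n
lower S p i = p i ∸ indicator S i

module _ {n : ℕ} {S : Subset n} {p q : Position n} where

  Removes-∈ : Removes S p q → ∀ {i} → i ∈ S → q i + 1 ≡ p i
  Removes-∈ rem {i} i∈S = trans (cong (q i +_) (sym (indicator-∈ i∈S))) (height rem i)

  Removes-∉ : Removes S p q → ∀ {i} → i ∉ S → q i ≡ p i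
  Removes-∉ rem {i} i∉S =
    trans (sym (+-identityʳ (q i))) (trans (cong (q i +_) (sym (indicator-∉ i∉S))) (height rem i))

  Removes-nonempty : Removes S p q → ∀ {i} → i ∈ S → 1 ≤ p i
  Removes-nonempty rem {i} i∈S = subst (1 ≤_) (Removes-∈ rem i∈S) (m≤n+m 1 (q i))

  Removes⇒Move : ∀ {A} → A ∣ S ∣ → Removes S p q → Move A p q
  Removes⇒Move a rem = S , a , (λ _ → chosen) , (λ _ → Removes-∉ rem)
    where
    chosen : ∀ {i} → i ∈ S → 1 ≤ p i × q i ≡ p i ∸ 1
    chosen {i} i∈S = Removes-nonempty rem i∈S
                   , trans (sym (m+n∸n≡m (q i) 1)) (cong (_∸ 1) (Removes-∈ rem i∈S))

  sum-Removes : Removes S p q → sum q + ∣ S ∣ ≡ sum p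
  sum-Removes rem = begin
    sum q + ∣ S ∣                 ≡⟨ cong (sum q +_) (∣S∣≡sum-indicator S) ⟩
    sum q + sum (indicator S)     ≡⟨ ∑-distrib-+ q (indicator S) ⟨
    sum (λ i → q i + indicator S i) ≡⟨ sum-cong-≗ (height rem) ⟩
    sum p                         ∎
    where open ≡-Reasoning

Move⇒Removes : ∀ {n A} {p q : Position n} (mv : Move A p q) → Removes (proj₁ mv) p q
Move⇒Removes {p = p} {q} (S , _ , chosen , kept) = removes height-of
  where
  height-of : ∀ i → q i + indicator S i ≡ p i
  height-of i with i ∈? S
  ... | yes i∈S = begin
    q i + indicator S i ≡⟨ cong₂ _+_ (proj₂ (chosen i i∈S)) (indicator-∈ i∈S) ⟩
    p i ∸ 1 + 1         ≡⟨ m∸n+n≡m (proj₁ (chosen i i∈S)) ⟩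
    p i                 ∎
    where open ≡-Reasoning
  ... | no  i∉S = trans (cong₂ _+_ (kept i i∉S) (indicator-∉ i∉S)) (+-identityʳ (p i))

Removes-lower : ∀ {n} {S : Subset n} {p : Position n} →
                (∀ {i} → i ∈ S → 1 ≤ p i) → Removes S p (lower S p)
Removes-lower {S = S} {p} nonempty = removes height-of
  where
  height-of : ∀ i → lower S p i + indicator S i ≡ p i
  height-of i with i ∈? S
  ... | yes i∈S rewrite indicator-∈ i∈S = m∸n+n≡m (nonempty i∈S)
  ... | no  i∉S rewrite indicator-∉ i∉S = +-identityʳ (p i)

module _ {n : ℕ} {S : Subset n} {p q : Position n} (rem : Removes S p q) where

  ∣S∣≤oddSum : ∣ S ∣ ≤ oddSum p + oddSum q
  ∣S∣≤oddSum = begin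
    ∣ S ∣                         ≡⟨ ∣S∣≡sum-indicator S ⟩
    sum (indicator S)             ≤⟨ sum-mono-≤ flips ⟩
    sum (λ i → p i % 2 + q i % 2) ≡⟨ ∑-distrib-+ (λ i → p i % 2) (λ i → q i % 2) ⟩
    oddSum p + oddSum q           ∎
    where
    open ≤-Reasoning
    flips : ∀ i → indicator S i ≤ p i % 2 + q i % 2
    flips i with i ∈? S
    ... | yes i∈S = ≤-reflexive (trans (indicator-∈ i∈S) (sym (%2-flip (Removes-∈ rem i∈S))))
    ... | no  i∉S = ≤-trans (≤-reflexive (indicator-∉ i∉S)) z≤n

  oddSum-Removes : (∀ {i} → i ∉ S → p i % 2 ≡ 0) → oddSum p + oddSum q ≡ ∣ S ∣
  oddSum-Removes even = begin
    oddSum p + oddSum q           ≡⟨ ∑-distrib-+ (λ i → p i % 2) (λ i → q i % 2) ⟨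
    sum (λ i → p i % 2 + q i % 2) ≡⟨ sum-cong-≗ flips ⟩
    sum (indicator S)             ≡⟨ ∣S∣≡sum-indicator S ⟨
    ∣ S ∣                         ∎
    where
    open ≡-Reasoning
    flips : ∀ i → p i % 2 + q i % 2 ≡ indicator S i
    flips i with i ∈? S
    ... | yes i∈S = trans (%2-flip (Removes-∈ rem i∈S)) (sym (indicator-∈ i∈S))
    ... | no  i∉S = trans (cong₂ _+_ (even i∉S) (trans (cong (_% 2) (Removes-∉ rem i∉S)) (even i∉S)))
                          (sym (indicator-∉ i∉S))

indicator≤removed : ∀ {n} {S : Subset n} {p q : Position n} → Removes S p q → ∀ i → indicator S i ≤ p i
indicator≤removed {q = q} rem i = subst (_ ≤_) (height rem i) (m≤n+m _ (q i))

Removes-≤ : ∀ {n} {S : Subset n} {p q : Position n} → Removes S p q → ∀ i → q i ≤ p i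
Removes-≤ {q = q} rem i = subst (q i ≤_) (height rem i) (m≤m+n (q i) _)

two-outside : ∀ {n} {S : Subset n} {i j} → i ≢ j → i ∉ S → j ∉ S → 2 + ∣ S ∣ ≤ n
two-outside {n} {S} {i} {j} i≢j i∉S j∉S = begin
  2 + ∣ S ∣                          ≡⟨ cong (_+ ∣ S ∣) (cong₂ _+_ (gap i∉S) (gap j∉S)) ⟨
  gap-at i + gap-at j + ∣ S ∣         ≤⟨ +-monoˡ-≤ ∣ S ∣ (f+f≤sum gap-at i≢j) ⟩
  sum gap-at + ∣ S ∣                 ≡⟨ cong (sum gap-at +_) (∣S∣≡sum-indicator S) ⟩
  sum gap-at + sum (indicator S)     ≡⟨ ∑-distrib-+ gap-at (indicator S) ⟨
  sum (λ x → gap-at x + indicator S x) ≡⟨ sum-cong-≗ (λ x → m∸n+n≡m (indicator≤1 S x)) ⟩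
  sum {n} (λ _ → 1)                  ≡⟨ sum-const n 1 ⟩
  n * 1                              ≡⟨ *-identityʳ n ⟩
  n                                  ∎
  where
  open ≤-Reasoning
  gap-at : Fin n → ℕ
  gap-at x = 1 ∸ indicator S x
  gap : ∀ {x} → x ∉ S → gap-at x ≡ 1
  gap x∉S = cong (1 ∸_) (indicator-∉ x∉S)

-- Outcomes when every move takes at least L tokens

P-N-disjoint : ∀ {n} {A : ℕ → Set} {p : Position n} → IsP A p → IsN A p → ⊥
P-N-disjoint (isP loses) (isN q mv q-loses) = P-N-disjoint q-loses (loses q mv)

module LargeMoves {n : ℕ} {A : ℕ → Set} {L : ℕ} (large : ∀ {ℓ} → A ℓ → L ≤ ℓ) where

  -- A move lowers Σ min(qᵢ, B + 1) by at least L, so MoveBound B q leaves at most B more moves;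
  -- stacks of height at least B can then never be emptied, and lowering them keeps the outcome.
  MoveBound : ℕ → Position n → Set
  MoveBound B q = sum (λ i → q i ⊓ suc B) < L * suc B

  Agrees : ℕ → Position n → Position n → Set
  Agrees B q c = ∀ i → c i ≡ q i ⊎ (B ≤ c i × c i ≤ q i)

  Shadow : ℕ → Position n → Position n → Set
  Shadow B q c = MoveBound B q × Agrees B q c

  module _ {S : Subset n} {q q′ : Position n} (rem : Removes S q q′) (a : A ∣ S ∣) where

    MoveBound-zero : ¬ MoveBound 0 q
    MoveBound-zero bound = <⇒≱ bound (begin
      L * 1                  ≡⟨ *-identityʳ L ⟩
      L                      ≤⟨ large a ⟩
      ∣ S ∣                  ≡⟨ ∣S∣≡sum-indicator S ⟩
      sum (indicator S)      ≤⟨ sum-mono-≤ (λ i → ⊓-glb (indicator≤removed rem i) (indicator≤1 S i)) ⟩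
      sum (λ i → q i ⊓ 1)    ∎)
      where open ≤-Reasoning

    MoveBound-pred : ∀ {B} → MoveBound (suc B) q → MoveBound B q′
    MoveBound-pred {B} bound = +-cancelʳ-< ∣ S ∣ _ _ (begin-strict
      sum (λ i → q′ i ⊓ suc B) + ∣ S ∣ ≡⟨ cong (sum (λ i → q′ i ⊓ suc B) +_) (∣S∣≡sum-indicator S) ⟩
      sum (λ i → q′ i ⊓ suc B) + sum (indicator S)
        ≡⟨ ∑-distrib-+ (λ i → q′ i ⊓ suc B) (indicator S) ⟨
      sum (λ i → q′ i ⊓ suc B + indicator S i) ≤⟨ sum-mono-≤ capped ⟩
      sum (λ i → q i ⊓ suc (suc B))   <⟨ bound ⟩
      L * suc (suc B)                 ≡⟨ *-suc L (suc B) ⟩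
      L + L * suc B                   ≤⟨ +-monoˡ-≤ (L * suc B) (large a) ⟩
      ∣ S ∣ + L * suc B               ≡⟨ +-comm ∣ S ∣ (L * suc B) ⟩
      L * suc B + ∣ S ∣               ∎)
      where
      open ≤-Reasoning
      capped : ∀ i → q′ i ⊓ suc B + indicator S i ≤ q i ⊓ suc (suc B)
      capped i with i ∈? S
      ... | yes i∈S = ≤-reflexive (begin-equality
        q′ i ⊓ suc B + indicator S i ≡⟨ cong (q′ i ⊓ suc B +_) (indicator-∈ i∈S) ⟩
        q′ i ⊓ suc B + 1             ≡⟨ +-comm (q′ i ⊓ suc B) 1 ⟩
        suc (q′ i) ⊓ suc (suc B)     ≡⟨ cong (_⊓ suc (suc B)) (trans (+-comm 1 (q′ i)) (Removes-∈ rem i∈S)) ⟩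
        q i ⊓ suc (suc B)            ∎)
      ... | no  i∉S = begin
        q′ i ⊓ suc B + indicator S i ≡⟨ cong (q′ i ⊓ suc B +_) (indicator-∉ i∉S) ⟩
        q′ i ⊓ suc B + 0             ≡⟨ +-identityʳ _ ⟩
        q′ i ⊓ suc B                 ≡⟨ cong (_⊓ suc B) (Removes-∉ rem i∉S) ⟩
        q i ⊓ suc B                  ≤⟨ ⊓-monoʳ-≤ (q i) (n≤1+n (suc B)) ⟩
        q i ⊓ suc (suc B)            ∎

  module _ {S : Subset n} {q q′ c c′ : Position n} (q-rem : Removes S q q′) (c-rem : Removes S c c′) where

    Agrees-pred : ∀ {B} → Agrees (suc B) q c → Agrees B q′ c′
    Agrees-pred {B} agrees i with agrees i
    ... | inj₁ same = inj₁ (+-cancelʳ-≡ (indicator S i) (c′ i) (q′ i)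
                              (trans (height c-rem i) (trans same (sym (height q-rem i)))))
    ... | inj₂ (tall , c≤q) =
      inj₂ (+-cancelʳ-≤ 1 B (c′ i) still-tall , +-cancelʳ-≤ (indicator S i) (c′ i) (q′ i) c′≤q′)
      where
      open ≤-Reasoning
      still-tall : B + 1 ≤ c′ i + 1
      still-tall = begin
        B + 1               ≡⟨ +-comm B 1 ⟩
        suc B               ≤⟨ tall ⟩
        c i                 ≡⟨ height c-rem i ⟨
        c′ i + indicator S i ≤⟨ +-monoʳ-≤ (c′ i) (indicator≤1 S i) ⟩
        c′ i + 1            ∎
      c′≤q′ : c′ i + indicator S i ≤ q′ i + indicator S i
      c′≤q′ = subst₂ _≤_ (sym (height c-rem i)) (sym (height q-rem i)) c≤q

  nonempty-from-q : ∀ {B S q q′ c} → Agrees (suc B) q c → Removes S q q′ → ∀ {i} → i ∈ S → 1 ≤ c i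
  nonempty-from-q agrees rem {i} i∈S with agrees i
  ... | inj₁ same      = subst (1 ≤_) (sym same) (Removes-nonempty rem i∈S)
  ... | inj₂ (tall , _) = ≤-trans (s≤s z≤n) tall

  nonempty-from-c : ∀ {B S q c c′} → Agrees B q c → Removes S c c′ → ∀ {i} → i ∈ S → 1 ≤ q i
  nonempty-from-c agrees rem {i} i∈S with agrees i
  ... | inj₁ same      = subst (1 ≤_) same (Removes-nonempty rem i∈S)
  ... | inj₂ (_ , c≤q) = ≤-trans (Removes-nonempty rem i∈S) c≤q

  mutual
    Shadow-P : ∀ {B q c} → Shadow B q c → IsP A c → IsP A q
    Shadow-P {zero}  (bound , _) _ =
      isP λ _ mv → ⊥-elim (MoveBound-zero (Move⇒Removes {A = A} mv) (proj₁ (proj₂ mv)) bound)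
    Shadow-P {suc B} {q} {c} (bound , agrees) (isP c-loses) = isP reply
      where
      reply : ∀ q′ → Move A q q′ → IsN A q′
      reply q′ mv@(S , a , _) = Shadow-N (MoveBound-pred q-rem a bound , Agrees-pred q-rem c-rem agrees)
                                         (c-loses (lower S c) (Removes⇒Move {A = A} a c-rem))
        where
        q-rem : Removes S q q′
        q-rem = Move⇒Removes {A = A} mv
        c-rem : Removes S c (lower S c)
        c-rem = Removes-lower (nonempty-from-q agrees q-rem)

    Shadow-N : ∀ {B q c} → Shadow B q c → IsN A c → IsN A q
    Shadow-N {B} {q} {c} (bound , agrees) (isN c′ mv@(S , a , _) c′-loses) = reply B bound agrees
      where
      c-rem : Removes S c c′
      c-rem = Move⇒Removes {A = A} mv
      reply : ∀ B → MoveBound B q → Agrees B q c → IsN A q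
      reply zero    bound agrees = ⊥-elim (MoveBound-zero (Removes-lower (nonempty-from-c agrees c-rem)) a bound)
      reply (suc B) bound agrees =
        isN (lower S q) (Removes⇒Move {A = A} a q-rem)
            (Shadow-P (MoveBound-pred q-rem a bound , Agrees-pred q-rem c-rem agrees) c′-loses)
        where
        q-rem : Removes S q (lower S q)
        q-rem = Removes-lower (nonempty-from-c agrees c-rem)

  Shadow-refl : 1 ≤ L → ∀ q → Shadow (sum q) q q
  Shadow-refl 1≤L q = bound , λ _ → inj₁ refl
    where
    open ≤-Reasoning
    bound : MoveBound (sum q) q
    bound = begin-strict
      sum (λ i → q i ⊓ suc (sum q)) ≤⟨ sum-mono-≤ (λ i → m⊓n≤m (q i) _) ⟩
      sum q                         <⟨ n<1+n (sum q) ⟩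
      suc (sum q)                   ≡⟨ *-identityˡ (suc (sum q)) ⟨
      1 * suc (sum q)               ≤⟨ *-monoˡ-≤ (suc (sum q)) 1≤L ⟩
      L * suc (sum q)               ∎

  sum-reachable : ∀ {p t : Position n} → Star (Move A) p t → ∀ i → sum t + L * p i ≤ sum p + L * t i
  sum-reachable ε i = ≤-refl
  sum-reachable {p} {t} (_◅_ {j = q} mv@(S , a , _) rest) i = begin
    sum t + L * p i                       ≡⟨ cong (λ x → sum t + L * x) (height rem i) ⟨
    sum t + L * (q i + indicator S i)     ≡⟨ cong (sum t +_) (*-distribˡ-+ L (q i) (indicator S i)) ⟩
    sum t + (L * q i + L * indicator S i) ≡⟨ +-assoc (sum t) (L * q i) (L * indicator S i) ⟨
    sum t + L * q i + L * indicator S i   ≤⟨ +-mono-≤ (sum-reachable rest i) L*indicator≤∣S∣ ⟩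
    sum q + L * t i + ∣ S ∣               ≡⟨ xy∙z≈xz∙y (sum q) (L * t i) ∣ S ∣ ⟩
    sum q + ∣ S ∣ + L * t i               ≡⟨ cong (_+ L * t i) (sum-Removes rem) ⟩
    sum p + L * t i                       ∎
    where
    open ≤-Reasoning
    rem : Removes S p q
    rem = Move⇒Removes {A = A} mv
    L*indicator≤∣S∣ : L * indicator S i ≤ ∣ S ∣
    L*indicator≤∣S∣ = ≤-trans (*-monoʳ-≤ L (indicator≤1 S i)) (≤-trans (≤-reflexive (*-identityʳ L)) (large a))

  Reduced⇒sum-bound : ∀ {p : Position n} → Reduced A p → ∀ i → L * p i ≤ sum p
  Reduced⇒sum-bound {p} reduced i with reduced i
  ... | zero , ((t , (reach , _) , tᵢ≡0) , _) , _ = begin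
    L * p i         ≤⟨ m≤n+m (L * p i) (sum t) ⟩
    sum t + L * p i ≤⟨ sum-reachable reach i ⟩
    sum p + L * t i ≡⟨ cong (λ x → sum p + L * x) tᵢ≡0 ⟩
    sum p + L * 0   ≡⟨ cong (sum p +_) (*-zeroʳ L) ⟩
    sum p + 0       ≡⟨ +-identityʳ (sum p) ⟩
    sum p           ∎
    where open ≤-Reasoning
  ... | suc u , _ , pᵢ∸u≡pᵢ =
    subst (λ x → L * x ≤ sum p) (sym (empty (p i) pᵢ∸u≡pᵢ)) (≤-trans (≤-reflexive (*-zeroʳ L)) z≤n)
    where
    empty : ∀ x → x ∸ suc u ≡ x → x ≡ 0
    empty zero    _  = refl
    empty (suc x) eq = contradiction (subst (_≤ x) eq (m∸n≤m x u)) 1+n≰n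

-- Residues modulo N = 2n − 2, where n = k + 2

module Residues (k : ℕ) where

  m : ℕ
  m = suc k

  n : ℕ
  n = suc m

  N : ℕ
  N = 2 * m

  N≡2+2k : N ≡ 2 + 2 * k
  N≡2+2k = *-suc 2 k

  2k<N : 2 * k < N
  2k<N = ≤-trans (n≤1+n (suc (2 * k))) (≤-reflexive (sym N≡2+2k))

  data Decrement (s ℓ s′ : ℕ) : Set where
    plain : ℓ ≤ s → s′ + ℓ ≡ s → Decrement s ℓ s′
    wrap  : s < ℓ → s′ + ℓ ≡ s + N → Decrement s ℓ s′

  residue-Decrement : ∀ {x x′ ℓ} → x′ + ℓ ≡ x → ℓ ≤ N → Decrement (x % N) ℓ (x′ % N)
  residue-Decrement {x} {x′} {ℓ} x′+ℓ≡x ℓ≤N = decrement (s′ + ℓ <? N)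
    where
    open ≡-Reasoning
    s′ : ℕ
    s′ = x′ % N
    fold : (s′ + ℓ) % N ≡ x % N
    fold = begin
      (x′ % N + ℓ) % N         ≡⟨ %-distribˡ-+ (x′ % N) ℓ N ⟩
      (x′ % N % N + ℓ % N) % N ≡⟨ cong (λ y → (y + ℓ % N) % N) (m%n%n≡m%n x′ N) ⟩
      (x′ % N + ℓ % N) % N     ≡⟨ %-distribˡ-+ x′ ℓ N ⟨
      (x′ + ℓ) % N             ≡⟨ cong (_% N) x′+ℓ≡x ⟩
      x % N                    ∎
    decrement : Dec (s′ + ℓ < N) → Decrement (x % N) ℓ s′
    decrement (yes small) = plain (subst (ℓ ≤_) s′+ℓ≡s (m≤n+m ℓ s′)) s′+ℓ≡s
      where
      s′+ℓ≡s : s′ + ℓ ≡ x % N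
      s′+ℓ≡s = trans (sym (m<n⇒m%n≡m small)) fold
    decrement (no large) = wrap s<ℓ s′+ℓ≡s+N
      where
      N≤s′+ℓ : N ≤ s′ + ℓ
      N≤s′+ℓ = ≮⇒≥ large
      excess<N : s′ + ℓ ∸ N < N
      excess<N = subst (s′ + ℓ ∸ N <_) (m+n∸n≡m N N)
                       (∸-monoˡ-< (+-mono-<-≤ (m%n<n x′ N) ℓ≤N) N≤s′+ℓ)
      s≡excess : x % N ≡ s′ + ℓ ∸ N
      s≡excess = begin
        x % N                 ≡⟨ fold ⟨
        (s′ + ℓ) % N          ≡⟨ cong (_% N) (m∸n+n≡m N≤s′+ℓ) ⟨
        (s′ + ℓ ∸ N + N) % N  ≡⟨ [m+n]%n≡m%n (s′ + ℓ ∸ N) N ⟩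
        (s′ + ℓ ∸ N) % N      ≡⟨ m<n⇒m%n≡m excess<N ⟩
        s′ + ℓ ∸ N            ∎
      s′+ℓ≡s+N : s′ + ℓ ≡ x % N + N
      s′+ℓ≡s+N = trans (sym (m∸n+n≡m N≤s′+ℓ)) (cong (_+ N) (sym s≡excess))
      s<ℓ : x % N < ℓ
      s<ℓ = +-cancelʳ-< N (x % N) ℓ (subst₂ _<_ s′+ℓ≡s+N (+-comm N ℓ) (+-monoˡ-< ℓ (m%n<n x′ N)))

  residue-linear : ∀ {x} H e → x ≡ m * H + e → e < m → x % N ≡ m * (H % 2) + e
  residue-linear {x} H e x≡mH+e e<m = begin
    x % N                             ≡⟨ cong (_% N) (trans x≡mH+e regroup) ⟩
    (m * (H % 2) + e + H / 2 * N) % N ≡⟨ [m+kn]%n≡m%n (m * (H % 2) + e) (H / 2) N ⟩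
    (m * (H % 2) + e) % N             ≡⟨ m<n⇒m%n≡m below-N ⟩
    m * (H % 2) + e                   ∎
    where
    open ≡-Reasoning
    regroup : m * H + e ≡ m * (H % 2) + e + H / 2 * N
    regroup = begin
      m * H + e                     ≡⟨ cong (λ h → m * h + e) (m≡m%n+[m/n]*n H 2) ⟩
      m * (H % 2 + H / 2 * 2) + e   ≡⟨ distribute m (H % 2) (H / 2) e ⟩
      m * (H % 2) + e + H / 2 * N   ∎
      where
      distribute : ∀ a r q e → a * (r + q * 2) + e ≡ a * r + e + q * (2 * a)
      distribute = solve-∀
    below-N : m * (H % 2) + e < N
    below-N = ≤-trans (+-mono-≤-< (≤-trans (*-monoʳ-≤ m (≤-pred (m%n<n H 2))) (≤-reflexive (*-identityʳ m))) e<m)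
                      (≤-reflexive (cong (m +_) (sym (+-identityʳ m))))

  residue-%2 : ∀ x → x % N % 2 ≡ x % 2
  residue-%2 x = m∣n⇒o%n%m≡o%m 2 N x (m∣m*n m)

  PPair : ℕ → ℕ → Set
  PPair s o = o ≤ s × o + s ≤ 2 * k

  even-sum : ∀ {s o} → s % 2 ≡ o % 2 → (o + s) % 2 ≡ (2 * k) % 2
  even-sum {s} {o} s≡o = begin
    (o + s) % 2             ≡⟨ %-distribˡ-+ o s 2 ⟩
    (o % 2 + s % 2) % 2     ≡⟨ cong (λ x → (o % 2 + x) % 2) s≡o ⟩
    (o % 2 + o % 2) % 2     ≡⟨ cong (λ x → (o % 2 + x) % 2) (+-identityʳ (o % 2)) ⟨
    (2 * (o % 2)) % 2       ≡⟨ %2-double (o % 2) ⟩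
    0                       ≡⟨ %2-double k ⟨
    (2 * k) % 2             ∎
    where open ≡-Reasoning

  hot-gap : ∀ {s o} → s % 2 ≡ o % 2 → ¬ PPair s o → 2 + s ≤ o ⊎ N ≤ o + s
  hot-gap {s} {o} s≡o hot with o ≤? s
  ... | no  o≰s = inj₁ (%2-gap s≡o (≰⇒> o≰s))
  ... | yes o≤s with o + s ≤? 2 * k
  ...   | yes o+s≤2k = contradiction (o≤s , o+s≤2k) hot
  ...   | no  o+s≰2k = inj₂ (subst (_≤ o + s) (sym N≡2+2k) (%2-gap (sym (even-sum {s} {o} s≡o)) (≰⇒> o+s≰2k)))

  s≤o+2k : ∀ {s o} → s % 2 ≡ o % 2 → s < N → s ≤ o + 2 * k
  s≤o+2k {s} {suc o} _   s<N = ≤-trans (≤-pred (subst (s <_) N≡2+2k s<N)) (s≤s (m≤n+m (2 * k) o))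
  s≤o+2k {s} {zero}  s≡0 s<N with s ≤? 2 * k
  ... | yes s≤2k = s≤2k
  ... | no  s≰2k = contradiction (subst (s <_) N≡2+2k s<N)
                                 (≤⇒≯ (%2-gap (trans (%2-double k) (sym s≡0)) (≰⇒> s≰2k)))

  PPair-no-move : ∀ {s o s′ o′ ℓ} → PPair s o → PPair s′ o′ → Decrement s ℓ s′ → m ≤ ℓ → ℓ ≤ o + o′ → ⊥
  PPair-no-move {s} {o} {s′} {o′} {ℓ} (_ , o+s≤2k) (o′≤s′ , _) (plain _ s′+ℓ≡s) m≤ℓ ℓ≤o+o′ =
    <-irrefl refl (begin-strict
      ℓ + ℓ        ≤⟨ +-monoˡ-≤ ℓ ℓ≤o+o′ ⟩
      o + o′ + ℓ   ≤⟨ +-monoˡ-≤ ℓ (+-monoʳ-≤ o o′≤s′) ⟩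
      o + s′ + ℓ   ≡⟨ +-assoc o s′ ℓ ⟩
      o + (s′ + ℓ) ≡⟨ cong (o +_) s′+ℓ≡s ⟩
      o + s        ≤⟨ o+s≤2k ⟩
      2 * k        <⟨ 2k<N ⟩
      2 * m        ≤⟨ *-monoʳ-≤ 2 m≤ℓ ⟩
      2 * ℓ        ≡⟨ cong (ℓ +_) (+-identityʳ ℓ) ⟩
      ℓ + ℓ        ∎)
    where open ≤-Reasoning
  PPair-no-move {s} {o} {s′} {o′} {ℓ} (o≤s , _) (_ , o′+s′≤2k) (wrap _ s′+ℓ≡s+N) _ ℓ≤o+o′ =
    <-irrefl refl (begin-strict
      s′ + ℓ        ≤⟨ +-monoʳ-≤ s′ ℓ≤o+o′ ⟩
      s′ + (o + o′) ≡⟨ solve (s′ ∷ o ∷ o′ ∷ []) ⟩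
      o + (o′ + s′) ≤⟨ +-mono-≤ o≤s o′+s′≤2k ⟩
      s + 2 * k     <⟨ +-monoʳ-< s 2k<N ⟩
      s + N         ≡⟨ s′+ℓ≡s+N ⟨
      s′ + ℓ        ∎)
    where open ≤-Reasoning

  hot-gap-below-m : ∀ {s o} → s % 2 ≡ o % 2 → ¬ PPair s o → s < m → 2 + s ≤ o
  hot-gap-below-m {s} {o} s≡o hot s<m with hot-gap s≡o hot
  ... | inj₁ 2+s≤o = 2+s≤o
  ... | inj₂ N≤o+s = +-cancelʳ-≤ s (2 + s) o (begin
    2 + s + s             ≤⟨ +-monoˡ-≤ s (+-monoʳ-≤ 2 (≤-pred s<m)) ⟩
    2 + k + s             ≤⟨ +-monoʳ-≤ (2 + k) (≤-pred s<m) ⟩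
    2 + k + k             ≡⟨ solve (k ∷ []) ⟩
    2 * suc k             ≤⟨ N≤o+s ⟩
    o + s                 ∎)
    where open ≤-Reasoning

  cold-after-m : ∀ {s o s′ o′} → s % 2 ≡ o % 2 → s < N → ¬ PPair s o →
                 o + o′ ≡ m → Decrement s m s′ → PPair s′ o′
  cold-after-m {s} {o} {s′} {o′} s≡o s<N hot o+o′≡m (plain m≤s s′+m≡s) with hot-gap s≡o hot
  ... | inj₁ 2+s≤o = contradiction (≤-trans 2+s≤o (≤-trans (m≤m+n o o′) (≤-trans (≤-reflexive o+o′≡m) m≤s))) 2+n≰n
  ... | inj₂ N≤o+s = o′≤s′ , o′+s′≤2k
    where
    open ≤-Reasoning
    o′≤s′ : o′ ≤ s′
    o′≤s′ = +-cancelʳ-≤ N o′ s′ (begin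
      o′ + N                  ≤⟨ +-monoʳ-≤ o′ N≤o+s ⟩
      o′ + (o + s)            ≡⟨ solve (o′ ∷ o ∷ s ∷ []) ⟩
      (o + o′) + s            ≡⟨ cong₂ _+_ o+o′≡m (sym s′+m≡s) ⟩
      suc k + (s′ + suc k)    ≡⟨ solve (k ∷ s′ ∷ []) ⟩
      s′ + 2 * suc k          ∎)
    o′+s′≤2k : o′ + s′ ≤ 2 * k
    o′+s′≤2k = +-cancelʳ-≤ (o + m) (o′ + s′) (2 * k) (begin
      o′ + s′ + (o + suc k)   ≡⟨ solve (o′ ∷ s′ ∷ o ∷ k ∷ []) ⟩
      (o + o′) + (s′ + suc k) ≡⟨ cong₂ _+_ o+o′≡m s′+m≡s ⟩
      suc k + s               ≤⟨ +-monoʳ-≤ (suc k) (s≤o+2k {s} {o} s≡o s<N) ⟩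
      suc k + (o + 2 * k)     ≡⟨ solve (k ∷ o ∷ []) ⟩
      2 * k + (o + suc k)     ∎)
  cold-after-m {s} {o} {s′} {o′} s≡o s<N hot o+o′≡m (wrap s<m s′+m≡s+N) = o′≤s′ , o′+s′≤2k
    where
    open ≤-Reasoning
    o′≤s′ : o′ ≤ s′
    o′≤s′ = ≤-trans (≤-trans (m≤n+m o′ o) (≤-reflexive o+o′≡m)) (+-cancelʳ-≤ m m s′ (begin
      suc k + suc k           ≤⟨ +-monoʳ-≤ (suc k) (m≤n+m (suc k) s) ⟩
      suc k + (s + suc k)     ≡⟨ solve (k ∷ s ∷ []) ⟩
      s + 2 * suc k           ≡⟨ s′+m≡s+N ⟨
      s′ + suc k              ∎))
    o′+s′≤2k : o′ + s′ ≤ 2 * k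
    o′+s′≤2k = +-cancelʳ-≤ (o + m) (o′ + s′) (2 * k) (begin
      o′ + s′ + (o + suc k)     ≡⟨ solve (o′ ∷ s′ ∷ o ∷ k ∷ []) ⟩
      (o + o′) + (s′ + suc k)   ≡⟨ cong₂ _+_ o+o′≡m s′+m≡s+N ⟩
      suc k + (s + 2 * suc k)   ≡⟨ solve (k ∷ s ∷ []) ⟩
      2 * k + ((2 + s) + suc k) ≤⟨ +-monoʳ-≤ (2 * k) (+-monoˡ-≤ (suc k) (hot-gap-below-m {s} {o} s≡o hot s<m)) ⟩
      2 * k + (o + suc k)       ∎)

  cold-after-n : ∀ {s o s′ o′} → s % 2 ≡ o % 2 → s < N → ¬ PPair s o → s < m ⊎ o ≡ n →
                 o + o′ ≡ n → Decrement s n s′ → PPair s′ o′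
  cold-after-n s≡o s<N hot (inj₁ s<m) o+o′≡n (plain n≤s _) =
    contradiction (≤-trans s<m (n≤1+n m)) (≤⇒≯ n≤s)
  cold-after-n {s} {o} {s′} {o′} s≡o s<N hot (inj₁ s<m) o+o′≡n (wrap _ s′+n≡s+N) =
    ≤-trans o′≤k k≤s′ , o′+s′≤2k
    where
    open ≤-Reasoning
    2+s≤o : 2 + s ≤ o
    2+s≤o = hot-gap-below-m {s} {o} s≡o hot s<m
    o′≤k : o′ ≤ k
    o′≤k = +-cancelˡ-≤ 2 o′ k (begin
      2 + o′  ≤⟨ +-monoˡ-≤ o′ (≤-trans (m≤m+n 2 s) 2+s≤o) ⟩
      o + o′  ≡⟨ o+o′≡n ⟩
      2 + k   ∎)
    k≤s′ : k ≤ s′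
    k≤s′ = +-cancelʳ-≤ n k s′ (begin
      k + suc (suc k)  ≡⟨ solve (k ∷ []) ⟩
      2 * suc k        ≤⟨ m≤n+m (2 * suc k) s ⟩
      s + 2 * suc k    ≡⟨ s′+n≡s+N ⟨
      s′ + suc (suc k) ∎)
    o′+s′≤2k : o′ + s′ ≤ 2 * k
    o′+s′≤2k = +-cancelʳ-≤ (o + n) (o′ + s′) (2 * k) (begin
      o′ + s′ + (o + suc (suc k))     ≡⟨ solve (o′ ∷ s′ ∷ o ∷ k ∷ []) ⟩
      (o + o′) + (s′ + suc (suc k))   ≡⟨ cong₂ _+_ o+o′≡n s′+n≡s+N ⟩
      suc (suc k) + (s + 2 * suc k)   ≡⟨ solve (k ∷ s ∷ []) ⟩
      2 * k + ((2 + s) + suc (suc k)) ≤⟨ +-monoʳ-≤ (2 * k) (+-monoˡ-≤ (suc (suc k)) 2+s≤o) ⟩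
      2 * k + (o + suc (suc k))       ∎)
  cold-after-n {s} {o} {s′} {o′} s≡o s<N hot (inj₂ o≡n) o+o′≡n dec =
    subst (λ x → PPair s′ x) (sym o′≡0) (z≤n , s′≤2k dec)
    where
    open ≤-Reasoning
    o′≡0 : o′ ≡ 0
    o′≡0 = +-cancelˡ-≡ o o′ 0 (trans o+o′≡n (trans (sym o≡n) (sym (+-identityʳ o))))
    s′≤2k : Decrement s n s′ → s′ ≤ 2 * k
    s′≤2k (plain _ s′+n≡s) = +-cancelʳ-≤ 2 s′ (2 * k) (begin
      s′ + 2           ≤⟨ +-monoʳ-≤ s′ (s≤s (s≤s z≤n)) ⟩
      s′ + suc (suc k) ≡⟨ s′+n≡s ⟩
      s                ≤⟨ <⇒≤ s<N ⟩
      2 * suc k        ≡⟨ solve (k ∷ []) ⟩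
      2 * k + 2        ∎)
    s′≤2k (wrap s<n s′+n≡s+N) = +-cancelʳ-≤ n s′ (2 * k) (begin
      s′ + suc (suc k) ≡⟨ s′+n≡s+N ⟩
      s + 2 * suc k    ≤⟨ +-monoˡ-≤ (2 * suc k) s≤k ⟩
      k + 2 * suc k    ≡⟨ solve (k ∷ []) ⟩
      2 * k + suc (suc k) ∎)
      where
      s≤k : s ≤ k
      s≤k with m≤n⇒m<n∨m≡n (≤-pred s<n)
      ... | inj₁ s<m = ≤-pred s<m
      ... | inj₂ s≡m = contradiction (trans (cong (_% 2) (sym s≡m)) (trans s≡o (cong (_% 2) o≡n))) (%2-suc≢ k)

  2n∸3≡1+2k : 2 * (2 + k) ∸ 3 ≡ suc (2 * k)
  2n∸3≡1+2k = trans (cong (_∸ 3) expand) (m+n∸m≡n 3 (suc (2 * k)))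
    where
    expand : 2 * suc (suc k) ≡ 3 + suc (2 * k)
    expand = solve (k ∷ [])

  S₁₂₃ : ℕ → ℕ → Set
  S₁₂₃ s o = S₁ (2 + k) s o ⊎ S₂ (2 + k) s o ⊎ S₃ (2 + k) s o

  PPair⇔S : ∀ {s o} → s % 2 ≡ o % 2 → PPair s o ⇔ (S₁₂₃ s o)
  PPair⇔S {s} {o} s≡o = mk⇔ to from
    where
    to : PPair s o → S₁₂₃ s o
    to (o≤s , o+s≤2k) with <-cmp s k
    ... | tri< s<k _ _ = inj₁ (s≡o , s<k , o≤s)
    ... | tri≈ _ s≡k _ = inj₂ (inj₁ (s≡k , trans (sym s≡o) (cong (_% 2) s≡k) , subst (o ≤_) s≡k o≤s))
    ... | tri> _ _ k<s = inj₂ (inj₂ (s≡o , k<s , subst (s <_) (sym 2n∸3≡1+2k) (s≤s (≤-trans (m≤n+m s o) o+s≤2k))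
                                    , m+n≤o⇒m≤o∸n o o+s≤2k))
    from : S₁₂₃ s o → PPair s o
    from (inj₁ (_ , s<k , o≤s)) =
      o≤s , ≤-trans (+-monoˡ-≤ s o≤s) (+-mono-≤ (<⇒≤ s<k) (≤-trans (<⇒≤ s<k) (≤-reflexive (sym (+-identityʳ k)))))
    from (inj₂ (inj₁ (refl , _ , o≤k))) =
      o≤k , ≤-trans (+-monoˡ-≤ s o≤k) (≤-reflexive (cong (k +_) (sym (+-identityʳ k))))
    from (inj₂ (inj₂ (_ , k<s , s<2n∸3 , o≤2k∸s))) =
      ≤-trans o≤2k∸s (m≤n+o⇒m∸n≤o (2 * k) s (+-mono-≤ (<⇒≤ k<s) (≤-trans (≤-reflexive (+-identityʳ k)) (<⇒≤ k<s))))
      , m≤o∸n⇒m+n≤o o (≤-pred (subst (s <_) 2n∸3≡1+2k s<2n∸3)) o≤2k∸s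

-- The game SN(n, {n − 1, n})

module Game (k : ℕ) where

  open Residues k

  Pos : Set
  Pos = Position n

  A : ℕ → Set
  A = A₆ n

  A-min : ∀ {ℓ} → A ℓ → m ≤ ℓ
  A-min (inj₁ refl) = ≤-refl
  A-min (inj₂ refl) = n≤1+n m

  A-max : ∀ {ℓ} → A ℓ → ℓ ≤ n
  A-max (inj₁ refl) = n≤1+n m
  A-max (inj₂ refl) = ≤-refl

  open LargeMoves {n = n} A-min

  n≤N : n ≤ N
  n≤N = subst₂ _≤_ (+-comm m 1) (cong (m +_) (sym (+-identityʳ m))) (+-monoʳ-≤ m (s≤s z≤n))

  A-⊤ : A ∣ ⊤ {n} ∣
  A-⊤ = inj₂ (∣⊤∣≡n n)

  ∣∁⁅⁆∣ : ∀ j → ∣ ∁ ⁅ j ⁆ ∣ ≡ m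
  ∣∁⁅⁆∣ j = trans (∣∁p∣≡n∸∣p∣ ⁅ j ⁆) (cong (n ∸_) (∣⁅x⁆∣≡1 j))

  A-∁⁅⁆ : ∀ j → A ∣ ∁ ⁅ j ⁆ ∣
  A-∁⁅⁆ j = inj₁ (∣∁⁅⁆∣ j)

  ∉∁⁅⁆ : ∀ {i j : Fin n} → i ∉ ∁ ⁅ j ⁆ → i ≡ j
  ∉∁⁅⁆ {j = j} = x∈⁅y⁆⇒x≡y j ∘ x∉∁p⇒x∈p

  sum-ones : sum {n} (λ _ → 1) ≡ n
  sum-ones = trans (sum-const n 1) (*-identityʳ n)

  -- Balance is the only consequence of reducedness that the argument uses.
  Balanced : Pos → Set
  Balanced p = ∀ i → m * p i ≤ sum p

  Reduced⇒Balanced : ∀ {p : Pos} → Reduced A p → Balanced p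
  Reduced⇒Balanced = Reduced⇒sum-bound

  residue : Pos → ℕ
  residue p = sum p % N

  Cold : Pos → Set
  Cold p = PPair (residue p) (oddSum p)

  residue-parity : ∀ p → residue p % 2 ≡ oddSum p % 2
  residue-parity p = trans (residue-%2 (sum p)) (sum-%2 p)

  Removes-Decrement : ∀ {S : Subset n} {c q : Pos} → Removes S c q → A ∣ S ∣ →
                      Decrement (residue c) ∣ S ∣ (residue q)
  Removes-Decrement rem a = residue-Decrement (sum-Removes rem) (≤-trans (A-max a) n≤N)

  cold-moves-to-hot : ∀ {S : Subset n} {c q : Pos} → Cold c → Removes S c q → A ∣ S ∣ → ¬ Cold q
  cold-moves-to-hot cold rem a cold-q =
    PPair-no-move cold cold-q (Removes-Decrement rem a) (A-min a) (∣S∣≤oddSum rem)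

  Removes-smaller : ∀ {S : Subset n} {c q : Pos} → Removes S c q → A ∣ S ∣ → sum q < sum c
  Removes-smaller {q = q} rem a =
    subst (sum q <_) (sum-Removes rem) (m<m+n (sum q) (≤-trans (s≤s z≤n) (A-min a)))

  balanced-below : ∀ {p H} → (∀ i → p i ≤ H) → m * H ≤ sum p → Balanced p
  balanced-below ≤H mH≤sum i = ≤-trans (*-monoʳ-≤ m (≤H i)) mH≤sum

  balanced-after-lowering-tallest : ∀ {S : Subset n} {c q : Pos} {M d} → sum c ≡ m * M + d →
                                    Removes S c q → (∀ i → q i + 1 ≤ M) → ∣ S ∣ ≤ m + d → Balanced q
  balanced-after-lowering-tallest {S} {c} {q} {M} {d} sum≡ rem q<M small i =
    +-cancelʳ-≤ ∣ S ∣ (m * q i) (sum q) (begin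
      m * q i + ∣ S ∣     ≤⟨ +-monoʳ-≤ (m * q i) small ⟩
      m * q i + (m + d)   ≡⟨ regroup m (q i) d ⟩
      m * (q i + 1) + d   ≤⟨ +-monoˡ-≤ d (*-monoʳ-≤ m (q<M i)) ⟩
      m * M + d           ≡⟨ sum≡ ⟨
      sum c               ≡⟨ sum-Removes rem ⟨
      sum q + ∣ S ∣       ∎)
    where
    open ≤-Reasoning
    regroup : ∀ a b e → a * b + (a + e) ≡ a * (b + 1) + e
    regroup = solve-∀

  balanced-after-small-move : ∀ {S : Subset n} {c q : Pos} {M d} → (∀ i → c i ≤ M) → sum c ≡ m * M + d →
                              Removes S c q → ∣ S ∣ ≤ d → Balanced q
  balanced-after-small-move {S} {c} {q} {M} {d} ≤M sum≡ rem small =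
    balanced-below (λ i → ≤-trans (Removes-≤ rem i) (≤M i)) (+-cancelʳ-≤ ∣ S ∣ (m * M) (sum q) (begin
      m * M + ∣ S ∣ ≤⟨ +-monoʳ-≤ (m * M) small ⟩
      m * M + d     ≡⟨ sum≡ ⟨
      sum c         ≡⟨ sum-Removes rem ⟨
      sum q + ∣ S ∣ ∎))
    where open ≤-Reasoning

  tallest : Pos → Fin n
  tallest c = argmax c zero (allFin n)

  ≤-tallest : ∀ c i → c i ≤ c (tallest c)
  ≤-tallest c i = All.lookup (f[xs]≤f[argmax] {f = c} zero (allFin n)) (∈-allFin i)

  record Shape (c : Pos) : Set where
    constructor shape
    field
      height excess : ℕ
      top           : Fin n
      top-height    : c top ≡ height
      ≤height       : ∀ i → c i ≤ height
      sum≡          : sum c ≡ m * height + excess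

  shape-of : ∀ {c} → Balanced c → Shape c
  shape-of {c} balanced =
    shape (c top) (sum c ∸ m * c top) top refl (≤-tallest c) (sym (m+[n∸m]≡n (balanced top)))
    where
    top : Fin n
    top = tallest c

  height-pos : ∀ {c : Pos} {M} → (∀ i → c i ≤ M) → 1 ≤ sum c → 1 ≤ M
  height-pos {M = suc _} _  _      = s≤s z≤n
  height-pos {c} {zero}  ≤M 1≤sum =
    contradiction (≤-trans 1≤sum (≤-trans (sum-mono-≤ ≤M) (≤-reflexive flat))) λ ()
    where
    flat : sum {n} (λ _ → 0) ≡ 0
    flat = trans (sum-const n 0) (*-zeroʳ n)

  two≤height : ∀ {c : Pos} {M} → (∀ i → 1 ≤ c i) → sum c ≡ m * M + 0 → 2 ≤ M
  two≤height {c} {M} positive sum≡ = ≰⇒> λ M≤1 → 1+n≰n (begin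
    n                 ≡⟨ sum-ones ⟨
    sum {n} (λ _ → 1) ≤⟨ sum-mono-≤ {f = λ _ → 1} positive ⟩
    sum c             ≡⟨ trans sum≡ (+-identityʳ (m * M)) ⟩
    m * M             ≤⟨ *-monoʳ-≤ m M≤1 ⟩
    m * 1             ≡⟨ *-identityʳ m ⟩
    m                 ∎)
    where open ≤-Reasoning

  two-empty⇒flat : ∀ {c : Pos} {M} → (∀ i → c i ≤ M) → m * M ≤ sum c →
                   ∀ {i j} → i ≢ j → c i ≡ 0 → c j ≡ 0 → M ≡ 0
  two-empty⇒flat {c} {M} ≤M mM≤sum {i} {j} i≢j ci≡0 cj≡0 = n≤0⇒n≡0 (+-cancelʳ-≤ (M + m * M) M 0 (begin
    M + (M + m * M)           ≤⟨ +-monoʳ-≤ M (+-monoʳ-≤ M mM≤sum) ⟩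
    M + (M + sum c)           ≡⟨ +-assoc M M (sum c) ⟨
    M + M + sum c             ≡⟨ cong (_+ sum c) (cong₂ _+_ (cong (M ∸_) ci≡0) (cong (M ∸_) cj≡0)) ⟨
    gap i + gap j + sum c     ≤⟨ +-monoˡ-≤ (sum c) (f+f≤sum gap i≢j) ⟩
    sum gap + sum c           ≡⟨ ∑-distrib-+ gap c ⟨
    sum (λ x → gap x + c x)   ≡⟨ sum-cong-≗ (λ x → m∸n+n≡m (≤M x)) ⟩
    sum {n} (λ _ → M)         ≡⟨ sum-const n M ⟩
    M + m * M                 ∎))
    where
    open ≤-Reasoning
    gap : Fin n → ℕ
    gap x = M ∸ c x

  Lowered : ℕ → Pos → Pos → Set
  Lowered M c q = ∀ i → q i + 1 ≡ c i ⊎ (q i ≡ M × c i ≡ M)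

  Removes⇒Lowered : ∀ {S : Subset n} {c q : Pos} {M} → Removes S c q → (∀ {i} → i ∉ S → c i ≡ M) →
                    Lowered M c q
  Removes⇒Lowered {S} rem untouched-tall i with i ∈? S
  ... | yes i∈S = inj₁ (Removes-∈ rem i∈S)
  ... | no  i∉S = inj₂ (trans (Removes-∉ rem i∉S) (untouched-tall i∉S) , untouched-tall i∉S)

  -- r stands in for q, which need not be balanced, when the induction hypothesis is applied at c.
  record Proxy (c q r : Pos) : Set where
    constructor proxy
    field
      bound    : ℕ
      shadow   : Shadow bound q r
      balanced : Balanced r
      smaller  : sum r < sum c

  self-proxy : ∀ {S : Subset n} {c q : Pos} → Removes S c q → A ∣ S ∣ → Balanced q → Proxy c q q
  self-proxy {q = q} rem a balanced = proxy (sum q) (Shadow-refl (s≤s z≤n) q) balanced (Removes-smaller rem a)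

  decrement : Pos → Pos
  decrement = lower ⊤

  module Decremented {c : Pos} (positive : ∀ i → 1 ≤ c i) where

    Removes-decrement : Removes ⊤ c (decrement c)
    Removes-decrement = Removes-lower (λ {i} _ → positive i)

    decrement+1 : ∀ i → decrement c i + 1 ≡ c i
    decrement+1 i = Removes-∈ Removes-decrement ∈⊤

    sum-decrement : sum (decrement c) + n ≡ sum c
    sum-decrement = trans (cong (sum (decrement c) +_) (sym (∣⊤∣≡n n))) (sum-Removes Removes-decrement)

    oddSum-decrement : oddSum c + oddSum (decrement c) ≡ n
    oddSum-decrement = trans (oddSum-Removes Removes-decrement (λ i∉⊤ → contradiction ∈⊤ i∉⊤)) (∣⊤∣≡n n)

    decrement-balanced : ∀ {M d} → (∀ i → c i ≤ M) → sum c ≡ m * M + d → 1 ≤ d → Balanced (decrement c)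
    decrement-balanced {d = d} ≤M sum≡ 1≤d with m≤n⇒∃[o]m+o≡n (≤-trans (positive zero) (≤M zero))
    ... | M′ , refl = balanced-below ≤M′ (+-cancelʳ-≤ n (m * M′) (sum (decrement c)) (begin
      suc k * M′ + suc (suc k)  ≡⟨ solve (k ∷ M′ ∷ []) ⟩
      suc k * suc M′ + 1        ≤⟨ +-monoʳ-≤ (m * suc M′) 1≤d ⟩
      m * suc M′ + d            ≡⟨ sum≡ ⟨
      sum c                     ≡⟨ sum-decrement ⟨
      sum (decrement c) + n     ∎))
      where
      open ≤-Reasoning
      ≤M′ : ∀ i → decrement c i ≤ M′
      ≤M′ i = ≤-pred (subst (_≤ suc M′) (trans (sym (decrement+1 i)) (+-comm _ 1)) (≤M i))

    decrement-proxy : ∀ {M d q} → (∀ i → c i ≤ M) → sum c ≡ m * M + d → 1 ≤ d → d ≤ k →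
                      Lowered M c q → sum q + m ≡ sum c → Proxy c q (decrement c)
    decrement-proxy {d = d} {q} ≤M sum≡ 1≤d d≤k lowered sum-q with m≤n⇒∃[o]m+o≡n (≤-trans (positive zero) (≤M zero))
    ... | M′ , refl = proxy M′ (bound , agrees) (decrement-balanced ≤M sum≡ 1≤d)
                            (Removes-smaller Removes-decrement A-⊤)
      where
      open ≤-Reasoning
      bound : MoveBound M′ q
      bound = begin-strict
        sum (λ i → q i ⊓ suc M′) ≤⟨ sum-mono-≤ (λ i → m⊓n≤m (q i) (suc M′)) ⟩
        sum q                    <⟨ +-cancelʳ-< m (sum q) (m * suc M′) (begin-strict
          sum q + m                ≡⟨ trans sum-q sum≡ ⟩
          m * suc M′ + d           <⟨ +-monoʳ-< (m * suc M′) (s≤s d≤k) ⟩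
          m * suc M′ + m           ∎) ⟩
        m * suc M′               ∎
      agrees : Agrees M′ q (decrement c)
      agrees i with lowered i
      ... | inj₁ q+1≡c = inj₁ (+-cancelʳ-≡ 1 (decrement c i) (q i) (trans (decrement+1 i) (sym q+1≡c)))
      ... | inj₂ (q≡M , c≡M) =
        inj₂ (≤-reflexive (sym r≡M′) , ≤-trans (≤-reflexive r≡M′) (≤-trans (n≤1+n M′) (≤-reflexive (sym q≡M))))
        where
        r≡M′ : decrement c i ≡ M′
        r≡M′ = suc-injective (trans (trans (+-comm 1 _) (decrement+1 i)) c≡M)

  tallSet : Pos → ℕ → Subset n
  tallSet c M = Vec.tabulate (λ i → does (c i ≟ M))

  ∈tallSet⇒ : ∀ {c : Pos} {M i} → i ∈ tallSet c M → c i ≡ M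
  ∈tallSet⇒ {c} {M} {i} i∈ with c i ≟ M
  ... | yes c≡M = c≡M
  ... | no  c≢M = contradiction (trans (sym (dec-false (c i ≟ M) c≢M))
                                       (trans (sym (lookup∘tabulate (λ j → does (c j ≟ M)) i)) ([]=⇒lookup i∈)))
                                λ ()

  tall⇒∈tallSet : ∀ {c : Pos} {M i} → c i ≡ M → i ∈ tallSet c M
  tall⇒∈tallSet {c} {M} {i} c≡M =
    lookup⇒[]= i (tallSet c M) (trans (lookup∘tabulate (λ j → does (c j ≟ M)) i) (dec-true (c i ≟ M) c≡M))

  -- When Σc = m·M, decrement c is no longer balanced, so stacks of height M lose a second token.
  trimmed : Pos → ℕ → Pos
  trimmed c M = lower (tallSet c M) (decrement c)

  module Trimmed {c : Pos} {H : ℕ} (positive : ∀ i → 1 ≤ c i) (≤M : ∀ i → c i ≤ 2 + H)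
                 (sum≡ : sum c ≡ m * (2 + H)) where

    open Decremented positive

    tall : Subset n
    tall = tallSet c (2 + H)

    trim : Pos
    trim = trimmed c (2 + H)

    tall-height : ∀ {i} → i ∈ tall → c i ≡ 2 + H
    tall-height = ∈tallSet⇒ {c} {2 + H}

    decrement-tall : ∀ {i} → i ∈ tall → decrement c i ≡ suc H
    decrement-tall {i} i∈ = suc-injective (trans (trans (+-comm 1 _) (decrement+1 i)) (tall-height i∈))

    Removes-trim : Removes tall (decrement c) trim
    Removes-trim = Removes-lower λ i∈ → subst (1 ≤_) (sym (decrement-tall i∈)) (s≤s z≤n)

    trim-tall : ∀ {i} → i ∈ tall → trim i ≡ H
    trim-tall {i} i∈ =
      suc-injective (trans (trans (+-comm 1 (trim i)) (Removes-∈ Removes-trim i∈)) (decrement-tall i∈))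

    trim-short : ∀ {i} → i ∉ tall → trim i + 1 ≡ c i
    trim-short {i} i∉ = trans (cong (_+ 1) (Removes-∉ Removes-trim i∉)) (decrement+1 i)

    short : ∀ {i} → i ∉ tall → c i ≢ 2 + H
    short i∉ = i∉ ∘ tall⇒∈tallSet {c} {2 + H}

    trim≤H : ∀ i → trim i ≤ H
    trim≤H i with i ∈? tall
    ... | yes i∈ = ≤-reflexive (trim-tall i∈)
    ... | no  i∉ = +-cancelʳ-≤ 1 (trim i) H (subst (_≤ H + 1) (sym (trim-short i∉))
                     (≤-trans (≤-pred (≤∧≢⇒< (≤M i) (short i∉))) (≤-reflexive (+-comm 1 H))))

    tall-count≤k : ∣ tall ∣ ≤ k
    tall-count≤k = ≤-pred (≰⇒> λ m≤j → 1+n≰n (+-cancelˡ-≤ (suc H * m) n m (begin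
      suc H * m + n               ≤⟨ +-monoˡ-≤ n (*-monoʳ-≤ (suc H) m≤j) ⟩
      suc H * ∣ tall ∣ + n         ≤⟨ count-bound ⟩
      suc H * m + m               ∎)))
      where
      open ≤-Reasoning
      capped : ∀ i → suc H * indicator tall i + 1 ≤ c i
      capped i with i ∈? tall
      ... | yes i∈ = ≤-reflexive (begin-equality
        suc H * indicator tall i + 1 ≡⟨ cong (λ x → suc H * x + 1) (indicator-∈ i∈) ⟩
        suc H * 1 + 1               ≡⟨ solve (H ∷ []) ⟩
        2 + H                       ≡⟨ tall-height i∈ ⟨
        c i                         ∎)
      ... | no  i∉ = subst (λ x → suc H * x + 1 ≤ c i) (sym (indicator-∉ i∉))
                           (subst (λ x → x + 1 ≤ c i) (sym (*-zeroʳ (suc H))) (positive i))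
      count-bound : suc H * ∣ tall ∣ + n ≤ suc H * m + m
      count-bound = begin
        suc H * ∣ tall ∣ + n
          ≡⟨ cong₂ _+_ (cong (suc H *_) (∣S∣≡sum-indicator tall)) (sym sum-ones) ⟩
        suc H * sum (indicator tall) + sum {n} (λ _ → 1)
          ≡⟨ cong (_+ sum {n} (λ _ → 1)) (*-distribˡ-sum (suc H) (indicator tall)) ⟩
        sum (λ i → suc H * indicator tall i) + sum {n} (λ _ → 1)
          ≡⟨ ∑-distrib-+ (λ i → suc H * indicator tall i) (λ _ → 1) ⟨
        sum (λ i → suc H * indicator tall i + 1) ≤⟨ sum-mono-≤ capped ⟩
        sum c                                 ≡⟨ sum≡ ⟩
        suc k * (2 + H)                       ≡⟨ solve (k ∷ H ∷ []) ⟩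
        suc H * suc k + suc k                 ∎

    sum-trim : sum trim ≡ m * H + (k ∸ ∣ tall ∣)
    sum-trim = begin
      sum trim                              ≡⟨ m+n∸n≡m (sum trim) ∣ tall ∣ ⟨
      sum trim + ∣ tall ∣ ∸ ∣ tall ∣          ≡⟨ cong (_∸ ∣ tall ∣) (+-cancelʳ-≡ n _ _ (begin
        sum trim + ∣ tall ∣ + n                 ≡⟨ cong (_+ n) (sum-Removes Removes-trim) ⟩
        sum (decrement c) + n                 ≡⟨ sum-decrement ⟩
        sum c                                 ≡⟨ sum≡ ⟩
        suc k * (2 + H)                       ≡⟨ solve (k ∷ H ∷ []) ⟩
        suc k * H + k + suc (suc k)           ∎)) ⟩
      m * H + k ∸ ∣ tall ∣                    ≡⟨ +-∸-assoc (m * H) tall-count≤k ⟩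
      m * H + (k ∸ ∣ tall ∣)                  ∎
      where open ≡-Reasoning

    residue-trim : residue trim ≡ m * (H % 2) + (k ∸ ∣ tall ∣)
    residue-trim = residue-linear H (k ∸ ∣ tall ∣) sum-trim (s≤s (m∸n≤m k ∣ tall ∣))

    trim-proxy : ∀ {q} → Lowered (2 + H) c q → Proxy c q trim
    trim-proxy {q} lowered = proxy H (bound , agrees) balanced smaller
      where
      open ≤-Reasoning
      capped : ∀ i → q i ⊓ suc H + 1 ≤ c i
      capped i with lowered i
      ... | inj₁ q+1≡c     = ≤-trans (+-monoˡ-≤ 1 (m⊓n≤m (q i) (suc H))) (≤-reflexive q+1≡c)
      ... | inj₂ (_ , c≡M) =
        ≤-trans (+-monoˡ-≤ 1 (m⊓n≤n (q i) (suc H))) (≤-reflexive (trans (+-comm (suc H) 1) (sym c≡M)))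
      bound : MoveBound H q
      bound = +-cancelʳ-≤ m (suc X) (m * suc H) (begin
        suc X + m                      ≡⟨ +-suc X m ⟨
        X + n                          ≡⟨ cong (X +_) sum-ones ⟨
        X + sum {n} (λ _ → 1)              ≡⟨ ∑-distrib-+ (λ i → q i ⊓ suc H) (λ _ → 1) ⟨
        sum (λ i → q i ⊓ suc H + 1)    ≤⟨ sum-mono-≤ capped ⟩
        sum c                          ≡⟨ sum≡ ⟩
        suc k * (2 + H)                ≡⟨ solve (k ∷ H ∷ []) ⟩
        suc k * suc H + suc k          ∎)
        where
        X : ℕ
        X = sum (λ i → q i ⊓ suc H)
      H≤q : ∀ {i} → i ∈ tall → H ≤ q i
      H≤q {i} i∈ with lowered i
      ... | inj₁ q+1≡c =
        ≤-trans (n≤1+n H) (≤-reflexive (sym (suc-injective (trans (trans (+-comm 1 (q i)) q+1≡c) (tall-height i∈)))))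
      ... | inj₂ (q≡M , _) = ≤-trans (≤-trans (n≤1+n H) (n≤1+n (suc H))) (≤-reflexive (sym q≡M))
      agrees : Agrees H q trim
      agrees i with i ∈? tall | lowered i
      ... | yes i∈ | _              =
        inj₂ (≤-reflexive (sym (trim-tall i∈)) , ≤-trans (≤-reflexive (trim-tall i∈)) (H≤q i∈))
      ... | no  i∉ | inj₁ q+1≡c     = inj₁ (+-cancelʳ-≡ 1 (trim i) (q i) (trans (trim-short i∉) (sym q+1≡c)))
      ... | no  i∉ | inj₂ (_ , c≡M) = contradiction c≡M (short i∉)
      balanced : Balanced trim
      balanced = balanced-below trim≤H (≤-trans (m≤m+n (m * H) _) (≤-reflexive (sym sum-trim)))
      smaller : sum trim < sum c
      smaller = ≤-<-trans (≤-trans (m≤m+n (sum trim) ∣ tall ∣) (≤-reflexive (sum-Removes Removes-trim)))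
                          (Removes-smaller Removes-decrement A-⊤)

    residue-c-even : H % 2 ≡ 0 → residue c ≡ 0
    residue-c-even H-even = trans (residue-linear (2 + H) 0 (trans sum≡ (sym (+-identityʳ _))) (s≤s z≤n))
                                  (cong (_+ 0) (trans (cong (m *_) H-even) (*-zeroʳ m)))

    residue-trim-even : H % 2 ≡ 0 → residue trim ≡ k ∸ ∣ tall ∣
    residue-trim-even H-even = trans residue-trim (cong (_+ (k ∸ ∣ tall ∣)) (trans (cong (m *_) H-even) (*-zeroʳ m)))

    residue-trim-odd : H % 2 ≡ 1 → residue trim ≡ m + (k ∸ ∣ tall ∣)
    residue-trim-odd H-odd = trans residue-trim (cong (_+ (k ∸ ∣ tall ∣)) (trans (cong (m *_) H-odd) (*-identityʳ m)))

    trim-hot-even : H % 2 ≡ 0 → Cold c → ¬ Cold trim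
    trim-hot-even H-even (o≤s , _) (o′≤s′ , _) = 1+n≰n (begin
      suc k                                      ≤⟨ n≤1+n (suc k) ⟩
      n                                          ≡⟨ sum-ones ⟨
      sum {n} (λ _ → 1)                          ≤⟨ sum-mono-≤ flips ⟩
      sum (λ i → trim i % 2 + indicator tall i)  ≡⟨ ∑-distrib-+ (λ i → trim i % 2) (indicator tall) ⟩
      oddSum trim + sum (indicator tall)         ≡⟨ cong (oddSum trim +_) (∣S∣≡sum-indicator tall) ⟨
      oddSum trim + ∣ tall ∣
        ≤⟨ +-monoˡ-≤ ∣ tall ∣ (≤-trans o′≤s′ (≤-reflexive (residue-trim-even H-even))) ⟩
      k ∸ ∣ tall ∣ + ∣ tall ∣                     ≡⟨ m∸n+n≡m tall-count≤k ⟩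
      k                                          ∎)
      where
      open ≤-Reasoning
      all-even : ∀ i → c i % 2 ≡ 0
      all-even i = n≤0⇒n≡0 (≤-trans (f≤sum (λ j → c j % 2) i) (≤-trans o≤s (≤-reflexive (residue-c-even H-even))))
      flips : ∀ i → 1 ≤ trim i % 2 + indicator tall i
      flips i with i ∈? tall
      ... | yes i∈ = subst (λ x → 1 ≤ trim i % 2 + x) (sym (indicator-∈ i∈)) (m≤n+m 1 (trim i % 2))
      ... | no  i∉ =
        ≤-trans (≤-reflexive (sym (trans (cong (_+ trim i % 2) (sym (all-even i))) (%2-flip (trim-short i∉)))))
                             (m≤m+n (trim i % 2) (indicator tall i))

    trim-hot-odd : H % 2 ≡ 1 → ¬ Cold trim
    trim-hot-odd H-odd (_ , o′+s′≤2k) = 1+n≰n (begin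
      suc (2 * k)                         ≡⟨ solve (k ∷ []) ⟩
      suc k + k                           ≡⟨ cong (suc k +_) (m+[n∸m]≡n tall-count≤k) ⟨
      suc k + (∣ tall ∣ + (k ∸ ∣ tall ∣))   ≡⟨ x∙yz≈y∙xz (suc k) ∣ tall ∣ (k ∸ ∣ tall ∣) ⟩
      ∣ tall ∣ + (m + (k ∸ ∣ tall ∣))       ≤⟨ +-mono-≤ count≤odd (≤-reflexive (sym (residue-trim-odd H-odd))) ⟩
      oddSum trim + residue trim          ≤⟨ o′+s′≤2k ⟩
      2 * k                               ∎)
      where
      open ≤-Reasoning
      tall-odd : ∀ i → indicator tall i ≤ trim i % 2
      tall-odd i with i ∈? tall
      ... | yes i∈ = ≤-reflexive (trans (indicator-∈ i∈) (sym (trans (cong (_% 2) (trim-tall i∈)) H-odd)))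
      ... | no  i∉ = ≤-trans (≤-reflexive (indicator-∉ i∉)) z≤n
      count≤odd : ∣ tall ∣ ≤ oddSum trim
      count≤odd = ≤-trans (≤-reflexive (∣S∣≡sum-indicator tall)) (sum-mono-≤ tall-odd)

    trim-hot : Cold c → ¬ Cold trim
    trim-hot cold with %2-cases H
    ... | inj₁ H-even = trim-hot-even H-even cold
    ... | inj₂ H-odd  = trim-hot-odd H-odd

    trim-cold : H % 2 ≡ 0 → (∀ i → c i ≢ 2 + H → c i % 2 ≡ 1) → Cold trim
    trim-cold H-even short-odd =
      subst (PPair (residue trim)) (sym oddSum≡0)
            (z≤n , ≤-trans (≤-reflexive (residue-trim-even H-even)) (≤-trans (m∸n≤m k ∣ tall ∣) (m≤m+n k (k + 0))))
      where
      trim-even : ∀ i → trim i % 2 ≡ 0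
      trim-even i with i ∈? tall
      ... | yes i∈ = trans (cong (_% 2) (trim-tall i∈)) H-even
      ... | no  i∉ =
        suc-injective (trans (cong (_+ trim i % 2) (sym (short-odd i (short i∉)))) (%2-flip (trim-short i∉)))
      oddSum≡0 : oddSum trim ≡ 0
      oddSum≡0 = trans (sum-cong-≗ trim-even) (trans (sum-const n 0) (*-zeroʳ n))

  trimmed-proxy : ∀ {c q : Pos} {M} → (∀ i → 1 ≤ c i) → (∀ i → c i ≤ M) → sum c ≡ m * M + 0 →
                  Lowered M c q → Proxy c q (trimmed c M)
  trimmed-proxy positive ≤M sum≡ lowered with m≤n⇒∃[o]m+o≡n (two≤height positive sum≡)
  ... | H , refl = trim-proxy lowered
    where open Trimmed positive ≤M (trans sum≡ (+-identityʳ (m * (2 + H))))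

  trimmed-hot : ∀ {c : Pos} {M} → (∀ i → 1 ≤ c i) → (∀ i → c i ≤ M) → sum c ≡ m * M + 0 →
                Cold c → ¬ Cold (trimmed c M)
  trimmed-hot positive ≤M sum≡ with m≤n⇒∃[o]m+o≡n (two≤height positive sum≡)
  ... | H , refl = trim-hot
    where open Trimmed positive ≤M (trans sum≡ (+-identityʳ (m * (2 + H))))

  trimmed-cold : ∀ {c : Pos} {M} → (∀ i → 1 ≤ c i) → (∀ i → c i ≤ M) → sum c ≡ m * M + 0 →
                 M % 2 ≡ 0 → (∀ i → c i ≢ M → c i % 2 ≡ 1) → Cold (trimmed c M)
  trimmed-cold positive ≤M sum≡ with m≤n⇒∃[o]m+o≡n (two≤height positive sum≡)
  ... | H , refl = trim-cold
    where open Trimmed positive ≤M (trans sum≡ (+-identityʳ (m * (2 + H))))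

  HotProxy : Pos → Pos → Set
  HotProxy c q = Σ Pos λ r → Proxy c q r × ¬ Cold r

  module FromCold {S : Subset n} {c q : Pos} (cold : Cold c) (rem : Removes S c q) (a : A ∣ S ∣) where

    self-hot : Balanced q → HotProxy c q
    self-hot balanced = q , self-proxy rem a balanced , cold-moves-to-hot cold rem a

    tallest-all-moved : ∀ {M d} → (∀ i → c i ≤ M) → sum c ≡ m * M + d → (∀ i → q i + 1 ≤ M) → HotProxy c q
    tallest-all-moved {M} {d} ≤M sum≡ q<M = by-size (∣ S ∣ ≤? m + d)
      where
      by-size : Dec (∣ S ∣ ≤ m + d) → HotProxy c q
      by-size (yes small) = self-hot (balanced-after-lowering-tallest sum≡ rem q<M small)
      by-size (no big) = trimmed c M , trimmed-proxy positive ≤M sum≡′ lowered , trimmed-hot positive ≤M sum≡′ cold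
        where
        full : A ∣ S ∣ → ∣ S ∣ ≡ n
        full (inj₁ ∣S∣≡m) = contradiction (≤-trans (≤-reflexive ∣S∣≡m) (m≤m+n m d)) big
        full (inj₂ ∣S∣≡n) = ∣S∣≡n
        ∣S∣≡n : ∣ S ∣ ≡ n
        ∣S∣≡n = full a
        d≡0 : d ≡ 0
        d≡0 = n≤0⇒n≡0 (≮⇒≥ λ 0<d → big (≤-trans (≤-reflexive (trans ∣S∣≡n (+-comm 1 m))) (+-monoʳ-≤ m 0<d)))
        sum≡′ : sum c ≡ m * M + 0
        sum≡′ = subst (λ x → sum c ≡ m * M + x) d≡0 sum≡
        all∈S : ∀ i → i ∈ S
        all∈S i = subst (i ∈_) (sym (∣p∣≡n⇒p≡⊤ ∣S∣≡n)) ∈⊤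
        positive : ∀ i → 1 ≤ c i
        positive i = Removes-nonempty rem (all∈S i)
        lowered : Lowered M c q
        lowered = Removes⇒Lowered rem λ {i} i∉S → contradiction (all∈S i) i∉S

    tallest-unmoved : ∀ {M d j} → j ∉ S → c j ≡ M → (∀ i → c i ≤ M) → sum c ≡ m * M + d → HotProxy c q
    tallest-unmoved {M} {d} {j} j∉S cj≡M ≤M sum≡ = by-excess (m ≤? d) (d ≟ 0)
      where
      one-short : A ∣ S ∣ → ∣ S ∣ ≡ m
      one-short (inj₁ ∣S∣≡m) = ∣S∣≡m
      one-short (inj₂ ∣S∣≡n) = contradiction (subst (j ∈_) (sym (∣p∣≡n⇒p≡⊤ ∣S∣≡n)) ∈⊤) j∉S
      ∣S∣≡m : ∣ S ∣ ≡ m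
      ∣S∣≡m = one-short a
      untouched-tall : ∀ {i} → i ∉ S → c i ≡ M
      untouched-tall {i} i∉S with i F.≟ j
      ... | yes refl = cj≡M
      ... | no  i≢j  = contradiction (subst (λ x → 2 + x ≤ n) ∣S∣≡m (two-outside i≢j i∉S j∉S)) (1+n≰n ∘ ≤-pred)
      lowered : Lowered M c q
      lowered = Removes⇒Lowered rem untouched-tall
      sum-q : sum q + m ≡ sum c
      sum-q = subst (λ x → sum q + x ≡ sum c) ∣S∣≡m (sum-Removes rem)
      positive : ∀ i → 1 ≤ c i
      positive i with i ∈? S
      ... | yes i∈S = Removes-nonempty rem i∈S
      ... | no  i∉S = subst (1 ≤_) (sym (untouched-tall i∉S))
                        (height-pos ≤M (≤-trans (s≤s z≤n) (≤-trans (m≤n+m m (sum q)) (≤-reflexive sum-q))))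
      by-excess : Dec (m ≤ d) → Dec (d ≡ 0) → HotProxy c q
      by-excess (yes m≤d) _ = self-hot (balanced-after-small-move ≤M sum≡ rem (≤-trans (≤-reflexive ∣S∣≡m) m≤d))
      by-excess (no  d≱m) (yes d≡0) =
        trimmed c M , trimmed-proxy positive ≤M sum≡′ lowered , trimmed-hot positive ≤M sum≡′ cold
        where
        sum≡′ : sum c ≡ m * M + 0
        sum≡′ = subst (λ x → sum c ≡ m * M + x) d≡0 sum≡
      by-excess (no  d≱m) (no  d≢0) = decrement c , proxy-c , cold-moves-to-hot cold Removes-decrement A-⊤
        where
        open Decremented positive
        proxy-c : Proxy c q (decrement c)
        proxy-c = decrement-proxy ≤M sum≡ (n≢0⇒n>0 d≢0) (≤-pred (≰⇒> d≱m)) lowered sum-q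

    hot-proxy : Shape c → HotProxy c q
    hot-proxy (shape M d _ _ ≤M sum≡) with any? (λ j → ¬? (j ∈? S) ×-dec (c j ≟ M))
    ... | yes (j , j∉S , cj≡M) = tallest-unmoved j∉S cj≡M ≤M sum≡
    ... | no  none             = tallest-all-moved ≤M sum≡ q<M
      where
      q<M : ∀ i → q i + 1 ≤ M
      q<M i with i ∈? S
      ... | yes i∈S = ≤-trans (≤-reflexive (Removes-∈ rem i∈S)) (≤M i)
      ... | no  i∉S = subst (_≤ M) (trans (cong suc (sym (Removes-∉ rem i∉S))) (+-comm 1 (q i)))
                            (≤∧≢⇒< (≤M i) λ ci≡M → none (i , i∉S , ci≡M))

  record Winning (c : Pos) : Set where
    constructor winning
    field
      {S}         : Subset n
      {q r}       : Pos
      removal     : Removes S c q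
      legal       : A ∣ S ∣
      represented : Proxy c q r
      cold        : Cold r

  module FromHot {c : Pos} (hot : ¬ Cold c) (sh : Shape c) where

    open Shape sh renaming (height to M; excess to d)

    same-parity : residue c % 2 ≡ oddSum c % 2
    same-parity = residue-parity c

    residue<N : residue c < N
    residue<N = m%n<n (sum c) N

    Decrement-⊤ : (positive : ∀ i → 1 ≤ c i) → Decrement (residue c) n (residue (decrement c))
    Decrement-⊤ positive = subst (λ ℓ → Decrement (residue c) ℓ (residue (decrement c))) (∣⊤∣≡n n)
                                 (Removes-Decrement (Decremented.Removes-decrement positive) A-⊤)

    spare : ∀ j → (∀ i → i ≢ j → 1 ≤ c i) → Removes (∁ ⁅ j ⁆) c (lower (∁ ⁅ j ⁆) c)
    spare j others = Removes-lower λ {i} i∈S → others i (x∉⁅y⁆⇒x≢y (x∈∁p⇒x∉p i∈S))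

    spare-flips : ∀ j {q} → Removes (∁ ⁅ j ⁆) c q → c j % 2 ≡ 0 → oddSum c + oddSum q ≡ m
    spare-flips j rem even =
      trans (oddSum-Removes rem (λ i∉S → subst (λ x → c x % 2 ≡ 0) (sym (∉∁⁅⁆ i∉S)) even)) (∣∁⁅⁆∣ j)

    spare-Decrement : ∀ j {q} → Removes (∁ ⁅ j ⁆) c q → Decrement (residue c) m (residue q)
    spare-Decrement j {q} rem = subst (λ ℓ → Decrement (residue c) ℓ (residue q)) (∣∁⁅⁆∣ j)
                                      (Removes-Decrement rem (A-∁⁅⁆ j))

    spare-even : ∀ j → c j % 2 ≡ 0 → c j < M → (∀ i → i ≢ j → 1 ≤ c i) → Winning c
    spare-even j even short others =
      winning rem (A-∁⁅⁆ j) (self-proxy rem (A-∁⁅⁆ j) balanced)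
              (cold-after-m same-parity residue<N hot (spare-flips j rem even) (spare-Decrement j rem))
      where
      rem : Removes (∁ ⁅ j ⁆) c (lower (∁ ⁅ j ⁆) c)
      rem = spare j others
      q<M : ∀ i → lower (∁ ⁅ j ⁆) c i + 1 ≤ M
      q<M i with i ∈? ∁ ⁅ j ⁆
      ... | yes i∈S = ≤-trans (≤-reflexive (Removes-∈ rem i∈S)) (≤height i)
      ... | no  i∉S = subst (_≤ M) (sym (trans (+-comm (lower (∁ ⁅ j ⁆) c i) 1)
                                             (cong suc (trans (Removes-∉ rem i∉S) (cong c (∉∁⁅⁆ i∉S))))))
                            short
      balanced : Balanced (lower (∁ ⁅ j ⁆) c)
      balanced = balanced-after-lowering-tallest sum≡ rem q<M (≤-trans (≤-reflexive (∣∁⁅⁆∣ j)) (m≤m+n m d))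

    residue-even : M % 2 ≡ 0 → d < m → residue c ≡ d
    residue-even M-even d<m =
      trans (residue-linear M d sum≡ d<m) (cong (_+ d) (trans (cong (m *_) M-even) (*-zeroʳ m)))

    spare-top : M % 2 ≡ 0 → (∀ i → 1 ≤ c i) → (∀ i → c i ≢ M → c i % 2 ≡ 1) → Winning c
    spare-top M-even positive short-odd = by-excess (m ≤? d) (d ≟ 0)
      where
      rem : Removes (∁ ⁅ top ⁆) c (lower (∁ ⁅ top ⁆) c)
      rem = spare top (λ i _ → positive i)
      a : A ∣ ∁ ⁅ top ⁆ ∣
      a = A-∁⁅⁆ top
      lowered : Lowered M c (lower (∁ ⁅ top ⁆) c)
      lowered = Removes⇒Lowered rem λ i∉S → trans (cong c (∉∁⁅⁆ i∉S)) top-height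
      sum-q : sum (lower (∁ ⁅ top ⁆) c) + m ≡ sum c
      sum-q = subst (λ ℓ → sum (lower (∁ ⁅ top ⁆) c) + ℓ ≡ sum c) (∣∁⁅⁆∣ top) (sum-Removes rem)
      by-excess : Dec (m ≤ d) → Dec (d ≡ 0) → Winning c
      by-excess (yes m≤d) _ = winning rem a (self-proxy rem a balanced) cold
        where
        balanced : Balanced (lower (∁ ⁅ top ⁆) c)
        balanced = balanced-after-small-move ≤height sum≡ rem (≤-trans (≤-reflexive (∣∁⁅⁆∣ top)) m≤d)
        cold : Cold (lower (∁ ⁅ top ⁆) c)
        cold = cold-after-m same-parity residue<N hot (spare-flips top rem (trans (cong (_% 2) top-height) M-even))
                            (spare-Decrement top rem)
      by-excess (no _) (yes d≡0) =
        winning rem a (trimmed-proxy positive ≤height sum≡′ lowered)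
                      (trimmed-cold positive ≤height sum≡′ M-even short-odd)
        where
        sum≡′ : sum c ≡ m * M + 0
        sum≡′ = subst (λ x → sum c ≡ m * M + x) d≡0 sum≡
      by-excess (no d≱m) (no d≢0) = winning rem a proxy-c cold
        where
        d≤k : d ≤ k
        d≤k = ≤-pred (≰⇒> d≱m)
        proxy-c : Proxy c (lower (∁ ⁅ top ⁆) c) (decrement c)
        proxy-c = Decremented.decrement-proxy positive ≤height sum≡ (n≢0⇒n>0 d≢0) d≤k lowered sum-q
        s<m : residue c < m
        s<m = subst (_< m) (sym (residue-even M-even (s≤s d≤k))) (s≤s d≤k)
        cold : Cold (decrement c)
        cold = cold-after-n same-parity residue<N hot (inj₁ s<m) (Decremented.oddSum-decrement positive)
                            (Decrement-⊤ positive)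

    all-odd : M % 2 ≡ 1 → (∀ i → 1 ≤ c i) → (∀ i → c i ≢ M → c i % 2 ≡ 1) → Winning c
    all-odd M-odd positive short-odd = by-excess (d ≟ 0)
      where
      open Decremented positive
      odd : ∀ i → c i % 2 ≡ 1
      odd i with c i ≟ M
      ... | yes ci≡M = trans (cong (_% 2) ci≡M) M-odd
      ... | no  ci≢M = short-odd i ci≢M
      oddSum≡n : oddSum c ≡ n
      oddSum≡n = trans (sum-cong-≗ odd) sum-ones
      rem : Removes ⊤ c (decrement c)
      rem = Removes-decrement
      by-excess : Dec (d ≡ 0) → Winning c
      -- d = 0 would give s = m while o = m + 1, against s ≡ o (mod 2).
      by-excess (yes d≡0) =
        contradiction (trans (sym (cong (_% 2) residue≡m)) (trans same-parity (cong (_% 2) oddSum≡n))) (%2-suc≢ m ∘ sym)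
        where
        residue≡m : residue c ≡ m
        residue≡m = trans (residue-linear M d sum≡ (subst (_< m) (sym d≡0) (s≤s z≤n)))
                          (trans (cong₂ (λ x y → m * x + y) M-odd d≡0) (trans (+-identityʳ (m * 1)) (*-identityʳ m)))
      by-excess (no d≢0) = winning rem A-⊤ (self-proxy rem A-⊤ balanced) cold
        where
        balanced : Balanced (decrement c)
        balanced = decrement-balanced ≤height sum≡ (n≢0⇒n>0 d≢0)
        cold : Cold (decrement c)
        cold = cold-after-n same-parity residue<N hot (inj₂ oddSum≡n) oddSum-decrement (Decrement-⊤ positive)

    sum-pos : 1 ≤ sum c
    sum-pos = n≢0⇒n>0 λ sum≡0 → hot (subst₂ PPair (sym (residue≡0 sum≡0)) (sym (oddSum≡0 sum≡0)) (z≤n , z≤n))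
      where
      residue≡0 : sum c ≡ 0 → residue c ≡ 0
      residue≡0 sum≡0 = cong (_% N) sum≡0
      oddSum≡0 : sum c ≡ 0 → oddSum c ≡ 0
      oddSum≡0 sum≡0 = n≤0⇒n≡0 (≤-trans (sum-mono-≤ (λ i → m%n≤m (c i) 2)) (≤-reflexive sum≡0))

    M≥1 : 1 ≤ M
    M≥1 = height-pos ≤height sum-pos

    mM≤sum : m * M ≤ sum c
    mM≤sum = ≤-trans (m≤m+n (m * M) d) (≤-reflexive (sym sum≡))

    winning-move : Winning c
    winning-move with any? (λ j → c j ≟ 0)
    ... | yes (j₀ , empty) = spare-even j₀ (cong (_% 2) empty) (subst (_< M) (sym empty) M≥1) others
      where
      others : ∀ i → i ≢ j₀ → 1 ≤ c i
      others i i≢j₀ = n≢0⇒n>0 λ ci≡0 →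
        contradiction (subst (1 ≤_) (two-empty⇒flat ≤height mM≤sum i≢j₀ ci≡0 empty) M≥1) λ ()
    ... | no  none = by-short-even (any? (λ j → (c j % 2 ≟ 0) ×-dec (suc (c j) ≤? M)))
      where
      positive : ∀ i → 1 ≤ c i
      positive i = n≢0⇒n>0 λ ci≡0 → none (i , ci≡0)
      by-short-even : Dec (∃ λ j → c j % 2 ≡ 0 × c j < M) → Winning c
      by-short-even (yes (j , even , short)) = spare-even j even short (λ i _ → positive i)
      by-short-even (no  none-even) = by-parity (%2-cases M)
        where
        short-odd : ∀ i → c i ≢ M → c i % 2 ≡ 1
        short-odd i ci≢M with %2-cases (c i)
        ... | inj₁ even = contradiction (i , even , ≤∧≢⇒< (≤height i) ci≢M) none-even
        ... | inj₂ odd  = odd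
        by-parity : M % 2 ≡ 0 ⊎ M % 2 ≡ 1 → Winning c
        by-parity (inj₁ M-even) = spare-top M-even positive short-odd
        by-parity (inj₂ M-odd)  = all-odd M-odd positive short-odd

  Classified : Pos → Set
  Classified c = (Cold c → IsP A c) × (¬ Cold c → IsN A c)

  ClassifiedBelow : Pos → Set
  ClassifiedBelow c = ∀ r → sum r < sum c → Balanced r → Classified r

  proxy-N : ∀ {c q r} → ClassifiedBelow c → Proxy c q r → ¬ Cold r → IsN A q
  proxy-N ih (proxy _ shadow balanced smaller) hot = Shadow-N shadow (proj₂ (ih _ smaller balanced) hot)

  proxy-P : ∀ {c q r} → ClassifiedBelow c → Proxy c q r → Cold r → IsP A q
  proxy-P ih (proxy _ shadow balanced smaller) cold = Shadow-P shadow (proj₁ (ih _ smaller balanced) cold)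

  cold⇒P : ∀ {c} → Balanced c → ClassifiedBelow c → Cold c → IsP A c
  cold⇒P balanced ih cold = isP λ q mv →
    let _ , represented , hot = FromCold.hot-proxy cold (Move⇒Removes {A = A} mv) (proj₁ (proj₂ mv))
                                                    (shape-of balanced)
    in proxy-N ih represented hot

  hot⇒N : ∀ {c} → Balanced c → ClassifiedBelow c → ¬ Cold c → IsN A c
  hot⇒N balanced ih hot = isN _ (Removes⇒Move {A = A} legal removal) (proxy-P ih represented cold)
    where open Winning (FromHot.winning-move hot (shape-of balanced))

  classify : ∀ t (c : Pos) → sum c < t → Balanced c → Classified c
  classify (suc t) c sum<t balanced = cold⇒P balanced ih , hot⇒N balanced ih
    where
    ih : ClassifiedBelow c
    ih r r<c = classify t r (<-≤-trans r<c (≤-pred sum<t))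

  P⇔Cold : ∀ {c} → Balanced c → IsP A c ⇔ Cold c
  P⇔Cold {c} balanced = mk⇔ to (proj₁ classified)
    where
    classified : Classified c
    classified = classify (suc (sum c)) c ≤-refl balanced
    to : IsP A c → Cold c
    to p with (oddSum c ≤? residue c) ×-dec (oddSum c + residue c ≤? 2 * k)
    ... | yes cold = cold
    ... | no  hot  = ⊥-elim (P-N-disjoint p (proj₂ classified hot))

theorem6 : (n : ℕ) → (h : 2 ≤ n) →
    ((p : Position n) → Sorted p → sVal n h p % 2 ≡ oddCount p % 2)
    × ((p : Position n) → Sorted p → Reduced (A₆ n) p →
    (IsP (A₆ n) p ⇔ (S₁ n (sVal n h p) (oddCount p) ⊎ S₂ n (sVal n h p) (oddCount p) ⊎ S₃ n (sVal n h p) (oddCount p))))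
theorem6 (suc (suc k)) h@(s≤s (s≤s z≤n)) = same-parity , characterisation
  where
  open Residues k
  open Game k
  sVal≡residue : ∀ p → sVal (2 + k) h p ≡ residue p
  sVal≡residue p = trans (%-congʳ {{>-nonZero (modulus-pos (2 + k) h)}} modulus≡N) (cong (_% N) (sum-allFin p))
    where
    modulus≡N : 2 * (2 + k) ∸ 2 ≡ N
    modulus≡N = trans (cong (_∸ 2) (*-suc 2 (suc k))) (m+n∸m≡n 2 N)
  same-parity : ∀ p → Sorted p → sVal (2 + k) h p % 2 ≡ oddCount p % 2
  same-parity p _ =
    trans (cong (_% 2) (sVal≡residue p)) (trans (residue-parity p) (cong (_% 2) (sym (oddCount≡oddSum p))))
  characterisation : ∀ p → Sorted p → Reduced A p → IsP A p ⇔ S₁₂₃ (sVal (2 + k) h p) (oddCount p)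
  characterisation p _ reduced rewrite sVal≡residue p | oddCount≡oddSum p =
    PPair⇔S (residue-parity p) ⇔-∘ P⇔Cold (Reduced⇒Balanced reduced)
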